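{- Let $A\in SL(2,\mathbb Z)$ with $|\operatorname{tr}A|>2$, let $D_A=4(\operatorname{tr}(A)^2-4)$, let $N$ be squarefree and coprime to $D_A$, and let $n\in\mathbb Z^2$ (a row vector) be such that $nA$ and $n$ are linearly independent modulo $p$ for every prime $p\mid N$. Then the number of $(i,j,k,l)$ with $1\le i,j,k,l\le\operatorname{ord}(A,N)$ and $$n(A^i-A^j+A^k-A^l)\equiv0\pmod N$$ is at most $3^{\omega(N)}\operatorname{ord}(A,N)^2$.
   Context: $\operatorname{ord}(A,N)$ is the least integer $k\ge1$ with $A^k\equiv I\pmod N$; $\omega(N)$ is the number of distinct prime divisors of $N$. -}

module Defs where

open import Data.Nat as ℕ using (ℕ; suc; _≤_; _<_)
open import Data.Nat.Divisibility as ℕD using (_∣?_)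
open import Data.Nat.Primality using (Prime; prime?)
open import Data.Nat.Coprimality using (Coprime)
open import Data.Integer as ℤ using (ℤ; +_; _+_; _-_; _*_; ∣_∣)
open import Data.Integer.Divisibility as ℤD using ()
open import Data.List using (List; length; filter; upTo; map; concatMap)
open import Data.Product using (_×_; _,_)
open import Relation.Nullary using (¬_; Dec)
open import Relation.Nullary.Decidable using (_×-dec_)

-- 2×2 integer matrices  [[a , b] , [c , d]]
record M2 : Set where
  constructor mat
  field
    a b c d : ℤ
open M2 public

_⊗_ : M2 → M2 → M2
mat a₁ b₁ c₁ d₁ ⊗ mat a₂ b₂ c₂ d₂ =
  mat (a₁ * a₂ + b₁ * c₂) (a₁ * b₂ + b₁ * d₂)
      (c₁ * a₂ + d₁ * c₂) (c₁ * b₂ + d₁ * d₂)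

I₂ : M2
I₂ = mat (+ 1) (+ 0) (+ 0) (+ 1)

_^^_ : M2 → ℕ → M2
A ^^ ℕ.zero = I₂
A ^^ suc k = A ⊗ (A ^^ k)

det : M2 → ℤ
det (mat a b c d) = a * d - b * c

tr : M2 → ℤ
tr (mat a b c d) = a + d

disc : M2 → ℤ
disc A = + 4 * (tr A * tr A - + 4)

_≡_[mod_] : ℤ → ℤ → ℕ → Set
x ≡ y [mod N ] = (+ N) ℤD.∣ (x - y)

_≡?_[mod_] : (x y : ℤ) (N : ℕ) → Dec (x ≡ y [mod N ])
x ≡? y [mod N ] = N ∣? ∣ x - y ∣

_≡M_[modM_] : M2 → M2 → ℕ → Set
A ≡M B [modM N ] =
  (a A ≡ a B [mod N ]) × (b A ≡ b B [mod N ]) ×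
  (c A ≡ c B [mod N ]) × (d A ≡ d B [mod N ])

IsOrd : M2 → ℕ → ℕ → Set
IsOrd A N k = 1 ≤ k × (A ^^ k) ≡M I₂ [modM N ] ×
              (∀ j → 1 ≤ j → j < k → ¬ ((A ^^ j) ≡M I₂ [modM N ]))

V2 : Set
V2 = ℤ × ℤ

_·_ : V2 → M2 → V2
(x , y) · mat a b c d = (x * a + y * c , x * b + y * d)

LinIndepMod : ℕ → V2 → V2 → Set
LinIndepMod p (u₁ , u₂) (v₁ , v₂) =
  ∀ (s t : ℤ) → (s * u₁ + t * v₁) ≡ + 0 [mod p ] →
                (s * u₂ + t * v₂) ≡ + 0 [mod p ] →
                (s ≡ + 0 [mod p ]) × (t ≡ + 0 [mod p ])

Squarefree : ℕ → Set
Squarefree N = ∀ p → Prime p → ¬ (p ℕ.* p ℕD.∣ N)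

ω : ℕ → ℕ
ω N = length (filter (λ p → prime? p ×-dec (p ∣? N)) (upTo (suc N)))

range1 : ℕ → List ℕ
range1 k = map suc (upTo k)

Quad : Set
Quad = ℕ × ℕ × ℕ × ℕ

quads : ℕ → List Quad
quads k = concatMap (λ i → concatMap (λ j → concatMap (λ l → map (λ m → (i , j , l , m))
            (range1 k)) (range1 k)) (range1 k)) (range1 k)

combo : V2 → M2 → Quad → V2
combo n A (i , j , k , l) =
  let (x₁ , y₁) = n · (A ^^ i)
      (x₂ , y₂) = n · (A ^^ j)
      (x₃ , y₃) = n · (A ^^ k)
      (x₄ , y₄) = n · (A ^^ l)
  in (x₁ - x₂ + x₃ - x₄ , y₁ - y₂ + y₃ - y₄)

IsSol : ℕ → V2 → M2 → Quad → Set
IsSol N n A q = let (x , y) = combo n A q in (x ≡ + 0 [mod N ]) × (y ≡ + 0 [mod N ])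

isSol? : ∀ N n A q → Dec (IsSol N n A q)
isSol? N n A q = let (x , y) = combo n A q in (x ≡? + 0 [mod N ]) ×-dec (y ≡? + 0 [mod N ])

solCount : ℕ → V2 → M2 → ℕ → ℕ
solCount N n A K = length (filter (isSol? N n A) (quads K))

-- Write v x = n A^x, and x ~ y when A^x ≡ A^y. Since det A = 1, the form
-- Q u = det₂ u (u A) = b u₁² + (d − a) u₁ u₂ − c u₂² is A-invariant, so Q ∘ v is constant, equal to
-- det₂ n (n A), which is a unit modulo every p ∣ N because n and n A are independent there. Modulo an
-- odd prime p not dividing the discriminant tr(A)² − 4 of Q, four vectors of the same nonzero value
-- with x + y ≡ z + w satisfy {x, y} ≡ {z, w} or x + y ≡ z + w ≡ 0; and v x ≡ v y forces x ~ y, again by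
-- the independence of n and n A. So modulo each p ∣ N a solution (i, j, k, l) has one of three shapes:
-- i ~ j and k ~ l, or i ~ l and k ~ j, or v i ≡ −v k and v j ≡ −v l. Fix a shape for every p. As N
-- is squarefree and K = ord(A, N), an exponent in [1, K] is determined by its classes modulo all p, so
-- l is determined by (i, j, k); given i, the exponent j lies in a coset of the group H₁ of h with
-- A^h ≡ I modulo the primes of the first shape, and given (i, j), k lies in a coset of the analogous
-- H₂₃ for the other primes. As H₁ ∩ H₂₃ is trivial, |H₁| |H₂₃| ≤ K, so each of the 3^ω(N) shape
-- assignments accounts for at most K · K solutions.
module Submission where

open import Defs
open import Data.Integer using (ℤ; +_; 0ℤ; 1ℤ; ∣_∣)
import Data.Integer.Properties as ℤₚ
open import Data.Integer.Divisibility.Signed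
  using (divides; ∣ᵤ⇒∣; ∣⇒∣ᵤ; ∣m∣n⇒∣m+n; ∣n⇒∣m*n; ∣m⇒∣-m)
  renaming (_∣_ to _∣ℤ_)
open import Data.Integer.Tactic.RingSolver using (solve-∀)
open import Data.Nat using (ℕ; zero; suc; z≤n; s≤s; NonZero; >-nonZero; _∸_; _≤?_)
import Data.Nat.Properties as ℕₚ
open import Data.Nat.Divisibility
  using (_∣_; _∣?_; ∣⇒≤; divides; ∣-refl; ∣-trans; ∣-reflexive; 1∣_; ∣1⇒≡1; m∣m*n; n∣m*n;
         *-monoʳ-∣; *-monoˡ-∣)
open import Data.Nat.Coprimality using (Coprime; coprime-divisor)
open import Data.Nat.ListAction using (sum; product)
open import Data.Nat.Primality using (Prime; prime?; euclidsLemma; ¬prime[1]; prime⇒irreducible)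
open import Data.Nat.Primality.Factorisation using (PrimeFactorisation; factorise)
open import Data.Product using (_×_; _,_; proj₁; proj₂; uncurry)
import Data.Product as Product
open import Data.Sum using (_⊎_; inj₁; inj₂; [_,_]′)
import Data.Sum as Sum
open import Data.List
  using (List; []; _∷_; _++_; length; filter; map; concatMap; cartesianProduct; upTo)
open import Data.List.Properties
  using (map-cong; length-++; length-map; length-upTo; length-removeAt′;
         filter-++; filter-none; filter-accept)
open import Data.List.Membership.Propositional using (_∈_; find)
open import Data.List.Membership.Propositional.Properties
  using (∈-++⁺ˡ; ∈-++⁺ʳ; ∈-map⁺; ∈-map⁻; ∈-upTo⁺; ∈-upTo⁻; ∈-filter⁺; ∈-filter⁻;
         ∈-cartesianProduct⁻)
open import Data.List.Relation.Binary.Subset.Propositional using (_⊆_)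
open import Data.List.Relation.Unary.All as All using (All; []; _∷_)
open import Data.List.Relation.Unary.All.Properties using (¬Any⇒All¬; ++⁺)
open import Data.List.Relation.Unary.AllPairs using (_∷_)
open import Data.List.Relation.Unary.Any using (any?; here; there; index; _─_)
open import Data.List.Relation.Unary.Unique.Propositional using (Unique)
import Data.List.Relation.Unary.Unique.Propositional.Properties as Unique
open import Function using (_∘_; id)
open import Level using (0ℓ)
open import Relation.Binary.Bundles using (Setoid)
open import Relation.Binary.Definitions using (tri<; tri≈; tri>)
open import Relation.Binary.PropositionalEquality
  using (_≡_; _≢_; refl; sym; trans; cong; cong₂; subst; subst₂; module ≡-Reasoning)
import Relation.Binary.Reasoning.Setoid as SetoidReasoning
open import Relation.Nullary using (¬_; Dec; yes; no; contradiction)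
open import Relation.Nullary.Decidable using (map′; _×-dec_; _⊎-dec_)
open import Relation.Unary using (Pred; Decidable; ∁)

module Congruence (m : ℕ) where

  open import Data.Integer using (_+_; _-_; _*_; -_)

  infix 4 _≈_ _≉_

  -- A record rather than a synonym for Defs' congruence, so that x and y can be inferred;
  -- the same goes for the other congruences below.
  record _≈_ (x y : ℤ) : Set where
    constructor from-mod
    field to-mod : x ≡ y [mod m ]
  open _≈_ public

  _≉_ : ℤ → ℤ → Set
  x ≉ y = ¬ x ≈ y

  _≈?_ : ∀ x y → Dec (x ≈ y)
  x ≈? y = map′ from-mod to-mod (x ≡? y [mod m ])

  ≈-by : ∀ {x y e} → e ≡ x - y → + m ∣ℤ e → x ≈ y
  ≈-by e≡x-y m∣e = from-mod (∣⇒∣ᵤ (subst (+ m ∣ℤ_) e≡x-y m∣e))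

  ≈⇒∣ : ∀ {x y} → x ≈ y → + m ∣ℤ x - y
  ≈⇒∣ = ∣ᵤ⇒∣ ∘ to-mod

  ≈-reflexive : ∀ {x y} → x ≡ y → x ≈ y
  ≈-reflexive {x} refl = ≈-by (sym (ℤₚ.+-inverseʳ x)) (divides 0ℤ refl)

  ≈-refl : ∀ {x} → x ≈ x
  ≈-refl = ≈-reflexive refl

  ≈-sym : ∀ {x y} → x ≈ y → y ≈ x
  ≈-sym {x} {y} x≈y = ≈-by (identity x y) (∣m⇒∣-m (≈⇒∣ x≈y))
    where
    identity : ∀ x y → - (x - y) ≡ y - x
    identity = solve-∀

  ≈-trans : ∀ {x y z} → x ≈ y → y ≈ z → x ≈ z
  ≈-trans {x} {y} {z} x≈y y≈z = ≈-by (identity x y z) (∣m∣n⇒∣m+n (≈⇒∣ x≈y) (≈⇒∣ y≈z))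
    where
    identity : ∀ x y z → (x - y) + (y - z) ≡ x - z
    identity = solve-∀

  ≈-setoid : Setoid _ _
  ≈-setoid = record
    { Carrier = ℤ
    ; _≈_ = _≈_
    ; isEquivalence = record { refl = ≈-refl ; sym = ≈-sym ; trans = ≈-trans }
    }

  module ≈-Reasoning = SetoidReasoning ≈-setoid

  +-cong : ∀ {x x' y y'} → x ≈ x' → y ≈ y' → x + y ≈ x' + y'
  +-cong {x} {x'} {y} {y'} x≈x' y≈y' =
    ≈-by (identity x x' y y') (∣m∣n⇒∣m+n (≈⇒∣ x≈x') (≈⇒∣ y≈y'))
    where
    identity : ∀ x x' y y' → (x - x') + (y - y') ≡ (x + y) - (x' + y')
    identity = solve-∀

  -‿cong : ∀ {x x'} → x ≈ x' → - x ≈ - x'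
  -‿cong {x} {x'} x≈x' = ≈-by (identity x x') (∣m⇒∣-m (≈⇒∣ x≈x'))
    where
    identity : ∀ x x' → - (x - x') ≡ - x - - x'
    identity = solve-∀

  -cong : ∀ {x x' y y'} → x ≈ x' → y ≈ y' → x - y ≈ x' - y'
  -cong x≈x' y≈y' = +-cong x≈x' (-‿cong y≈y')

  *-cong : ∀ {x x' y y'} → x ≈ x' → y ≈ y' → x * y ≈ x' * y'
  *-cong {x} {x'} {y} {y'} x≈x' y≈y' =
    ≈-by (identity x x' y y') (∣m∣n⇒∣m+n (∣n⇒∣m*n y (≈⇒∣ x≈x')) (∣n⇒∣m*n x' (≈⇒∣ y≈y')))
    where
    identity : ∀ x x' y y' → y * (x - x') + x' * (y - y') ≡ x * y - x' * y'
    identity = solve-∀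

  *-congˡ : ∀ z {y y'} → y ≈ y' → z * y ≈ z * y'
  *-congˡ z = *-cong (≈-refl {z})

  ≈⇒-≈0 : ∀ {x y} → x ≈ y → x - y ≈ 0ℤ
  ≈⇒-≈0 {x} {y} x≈y = ≈-by (sym (ℤₚ.+-identityʳ (x - y))) (≈⇒∣ x≈y)

  -≈0⇒≈ : ∀ {x y} → x - y ≈ 0ℤ → x ≈ y
  -≈0⇒≈ {x} {y} x-y≈0 = ≈-by (ℤₚ.+-identityʳ (x - y)) (≈⇒∣ x-y≈0)

  ≈0⇒∣ : ∀ {x} → x ≈ 0ℤ → + m ∣ℤ x
  ≈0⇒∣ {x} x≈0 = subst (+ m ∣ℤ_) (ℤₚ.+-identityʳ x) (≈⇒∣ x≈0)

  ∣⇒≈0 : ∀ {x} → + m ∣ℤ x → x ≈ 0ℤ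
  ∣⇒≈0 {x} = ≈-by (sym (ℤₚ.+-identityʳ x))

  ≈0-*ˡ : ∀ x {y} → y ≈ 0ℤ → x * y ≈ 0ℤ
  ≈0-*ˡ x y≈0 = ∣⇒≈0 (∣n⇒∣m*n x (≈0⇒∣ y≈0))

  +-cancelˡ-≈ : ∀ x {y y'} → x + y ≈ x + y' → y ≈ y'
  +-cancelˡ-≈ x {y} {y'} x+y≈x+y' = ≈-by (identity x y y') (≈⇒∣ x+y≈x+y')
    where
    identity : ∀ x y y' → (x + y) - (x + y') ≡ y - y'
    identity = solve-∀

  alternating≈0⇒sums≈ : ∀ {x y z w} → x - z + y - w ≈ 0ℤ → x + y ≈ z + w
  alternating≈0⇒sums≈ {x} {y} {z} {w} alternating≈0 =
    -≈0⇒≈ (subst (_≈ 0ℤ) (identity x y z w) alternating≈0)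
    where
    identity : ∀ x y z w → x - z + y - w ≡ (x + y) - (z + w)
    identity = solve-∀

module PrimeCongruence {p : ℕ} (p-prime : Prime p) where

  open import Data.Integer using (_+_; _-_; _*_; -_)
  open Congruence p

  *-≈0 : ∀ {x y} → x * y ≈ 0ℤ → x ≈ 0ℤ ⊎ y ≈ 0ℤ
  *-≈0 {x} {y} xy≈0 =
    Sum.map (∣⇒≈0 ∘ ∣ᵤ⇒∣) (∣⇒≈0 ∘ ∣ᵤ⇒∣)
      (euclidsLemma ∣ x ∣ ∣ y ∣ p-prime (subst (p ∣_) (ℤₚ.abs-* x y) (∣⇒∣ᵤ (≈0⇒∣ xy≈0))))

  *-≉0 : ∀ {x y} → x ≉ 0ℤ → y ≉ 0ℤ → x * y ≉ 0ℤ
  *-≉0 x≉0 y≉0 = [ x≉0 , y≉0 ]′ ∘ *-≈0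

  *-≈0-cancelˡ : ∀ {x y} → x ≉ 0ℤ → x * y ≈ 0ℤ → y ≈ 0ℤ
  *-≈0-cancelˡ x≉0 = [ (λ x≈0 → contradiction x≈0 x≉0) , id ]′ ∘ *-≈0

  *-cancelˡ-≈ : ∀ {x y z} → x ≉ 0ℤ → x * y ≈ x * z → y ≈ z
  *-cancelˡ-≈ {x} {y} {z} x≉0 xy≈xz =
    -≈0⇒≈ (*-≈0-cancelˡ x≉0 (subst (_≈ 0ℤ) (identity x y z) (≈⇒-≈0 xy≈xz)))
    where
    identity : ∀ x y z → x * y - x * z ≡ x * (y - z)
    identity = solve-∀

  square-≈0 : ∀ {x} → x * x ≈ 0ℤ → x ≈ 0ℤ
  square-≈0 = [ id , id ]′ ∘ *-≈0

  square-≈ : ∀ {x y} → x * x ≈ y * y → x ≈ y ⊎ x ≈ - y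
  square-≈ {x} {y} x²≈y² =
    Sum.map -≈0⇒≈ -≈0⇒≈ (*-≈0 (subst (_≈ 0ℤ) (identity x y) (≈⇒-≈0 x²≈y²)))
    where
    identity : ∀ x y → x * x - y * y ≡ (x - y) * (x - - y)
    identity = solve-∀

  halves : ∀ {x y z w} → + 2 ≉ 0ℤ → x + y ≈ z + w → x - y ≈ z - w → x ≈ z × y ≈ w
  halves {x} {y} {z} {w} 2≉0 sum≈ diff≈ =
    *-cancelˡ-≈ 2≉0 (subst₂ _≈_ (twice-first x y) (twice-first z w) (+-cong sum≈ diff≈)) ,
    *-cancelˡ-≈ 2≉0 (subst₂ _≈_ (twice-second x y) (twice-second z w) (-cong sum≈ diff≈))
    where
    twice-first : ∀ x y → (x + y) + (x - y) ≡ + 2 * x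
    twice-first = solve-∀
    twice-second : ∀ x y → (x + y) - (x - y) ≡ + 2 * y
    twice-second = solve-∀

  1≉0 : 1ℤ ≉ 0ℤ
  1≉0 1≈0 = ¬prime[1] (subst Prime (∣1⇒≡1 (∣⇒∣ᵤ (≈0⇒∣ 1≈0))) p-prime)

module _ where

  open import Data.Integer using (_+_; _-_; _*_)

  infixl 6 _+ᵥ_ _-ᵥ_

  _+ᵥ_ : V2 → V2 → V2
  u +ᵥ v = proj₁ u + proj₁ v , proj₂ u + proj₂ v

  _-ᵥ_ : V2 → V2 → V2
  u -ᵥ v = proj₁ u - proj₁ v , proj₂ u - proj₂ v

  0ᵥ : V2
  0ᵥ = 0ℤ , 0ℤ

  det₂ : V2 → V2 → ℤ
  det₂ (u₁ , u₂) (v₁ , v₂) = u₁ * v₂ - u₂ * v₁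

module VectorCongruence (m : ℕ) where

  open Congruence m

  infix 4 _≈ᵥ_

  record _≈ᵥ_ (u v : V2) : Set where
    constructor _,_
    field
      fst : proj₁ u ≈ proj₁ v
      snd : proj₂ u ≈ proj₂ v

  _≈ᵥ?_ : ∀ u v → Dec (u ≈ᵥ v)
  u ≈ᵥ? v = map′ (λ (≈₁ , ≈₂) → ≈₁ , ≈₂) (λ (≈₁ , ≈₂) → ≈₁ , ≈₂)
                 ((proj₁ u ≈? proj₁ v) ×-dec (proj₂ u ≈? proj₂ v))

  ≈ᵥ-refl : ∀ {u} → u ≈ᵥ u
  ≈ᵥ-refl = ≈-refl , ≈-refl

  ≈ᵥ-sym : ∀ {u v} → u ≈ᵥ v → v ≈ᵥ u
  ≈ᵥ-sym (u₁≈v₁ , u₂≈v₂) = ≈-sym u₁≈v₁ , ≈-sym u₂≈v₂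

  ≈ᵥ-trans : ∀ {u v w} → u ≈ᵥ v → v ≈ᵥ w → u ≈ᵥ w
  ≈ᵥ-trans (u₁≈v₁ , u₂≈v₂) (v₁≈w₁ , v₂≈w₂) = ≈-trans u₁≈v₁ v₁≈w₁ , ≈-trans u₂≈v₂ v₂≈w₂

  +ᵥ-comm : ∀ u v → u +ᵥ v ≈ᵥ v +ᵥ u
  +ᵥ-comm (u₁ , u₂) (v₁ , v₂) = ≈-reflexive (ℤₚ.+-comm u₁ v₁) , ≈-reflexive (ℤₚ.+-comm u₂ v₂)

  +ᵥ-cancelˡ : ∀ u {v v'} → u +ᵥ v ≈ᵥ u +ᵥ v' → v ≈ᵥ v'
  +ᵥ-cancelˡ u (≈₁ , ≈₂) = +-cancelˡ-≈ (proj₁ u) ≈₁ , +-cancelˡ-≈ (proj₂ u) ≈₂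

module BinaryQuadraticForm (P R S : ℤ) where

  open import Data.Integer using (_+_; _-_; _*_; -_)

  Q : V2 → ℤ
  Q (u₁ , u₂) = P * u₁ * u₁ + R * u₁ * u₂ + S * u₂ * u₂

  B : V2 → V2 → ℤ
  B (u₁ , u₂) (v₁ , v₂) = (+ 2 * P * u₁ + R * u₂) * v₁ + (R * u₁ + + 2 * S * u₂) * v₂

  Δ : ℤ
  Δ = R * R - + 4 * P * S

  B-sym : ∀ u v → B u v ≡ B v u
  B-sym (u₁ , u₂) (v₁ , v₂) = identity P R S u₁ u₂ v₁ v₂
    where
    identity : ∀ P R S u₁ u₂ v₁ v₂ →
      (+ 2 * P * u₁ + R * u₂) * v₁ + (R * u₁ + + 2 * S * u₂) * v₂ ≡
      (+ 2 * P * v₁ + R * v₂) * u₁ + (R * v₁ + + 2 * S * v₂) * u₂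
    identity = solve-∀

  B-zeroʳ : ∀ u → B u 0ᵥ ≡ 0ℤ
  B-zeroʳ (u₁ , u₂) = identity P R S u₁ u₂
    where
    identity : ∀ P R S u₁ u₂ → (+ 2 * P * u₁ + R * u₂) * 0ℤ + (R * u₁ + + 2 * S * u₂) * 0ℤ ≡ 0ℤ
    identity = solve-∀

  det₂-zeroʳ : ∀ u → det₂ u 0ᵥ ≡ 0ℤ
  det₂-zeroʳ (u₁ , u₂) = identity u₁ u₂
    where
    identity : ∀ u₁ u₂ → u₁ * 0ℤ - u₂ * 0ℤ ≡ 0ℤ
    identity = solve-∀

  det₂-swap : ∀ u z w → det₂ u (w -ᵥ z) ≡ - det₂ u (z -ᵥ w)
  det₂-swap (u₁ , u₂) (z₁ , z₂) (w₁ , w₂) = identity u₁ u₂ z₁ z₂ w₁ w₂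
    where
    identity : ∀ u₁ u₂ z₁ z₂ w₁ w₂ →
      u₁ * (w₂ - z₂) - u₂ * (w₁ - z₁) ≡ - (u₁ * (z₂ - w₂) - u₂ * (z₁ - w₁))
    identity = solve-∀

  B-sum-diff : ∀ x y → B (x +ᵥ y) (x -ᵥ y) ≡ + 2 * (Q x - Q y)
  B-sum-diff (x₁ , x₂) (y₁ , y₂) = identity P R S x₁ x₂ y₁ y₂
    where
    identity : ∀ P R S x₁ x₂ y₁ y₂ →
      (+ 2 * P * (x₁ + y₁) + R * (x₂ + y₂)) * (x₁ - y₁) +
        (R * (x₁ + y₁) + + 2 * S * (x₂ + y₂)) * (x₂ - y₂) ≡
      + 2 * ((P * x₁ * x₁ + R * x₁ * x₂ + S * x₂ * x₂) - (P * y₁ * y₁ + R * y₁ * y₂ + S * y₂ * y₂))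
    identity = solve-∀

  parallelogram : ∀ x y → Q (x -ᵥ y) ≡ + 2 * (Q x + Q y) - Q (x +ᵥ y)
  parallelogram (x₁ , x₂) (y₁ , y₂) = identity P R S x₁ x₂ y₁ y₂
    where
    identity : ∀ P R S x₁ x₂ y₁ y₂ →
      P * (x₁ - y₁) * (x₁ - y₁) + R * (x₁ - y₁) * (x₂ - y₂) + S * (x₂ - y₂) * (x₂ - y₂) ≡
      + 2 * ((P * x₁ * x₁ + R * x₁ * x₂ + S * x₂ * x₂) + (P * y₁ * y₁ + R * y₁ * y₂ + S * y₂ * y₂)) -
        (P * (x₁ + y₁) * (x₁ + y₁) + R * (x₁ + y₁) * (x₂ + y₂) + S * (x₂ + y₂) * (x₂ + y₂))
    identity = solve-∀

  B-discriminant : ∀ u v → B u v * B u v - + 4 * Q u * Q v ≡ Δ * (det₂ u v * det₂ u v)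
  B-discriminant (u₁ , u₂) (v₁ , v₂) = identity P R S u₁ u₂ v₁ v₂
    where
    identity : ∀ P R S u₁ u₂ v₁ v₂ →
      ((+ 2 * P * u₁ + R * u₂) * v₁ + (R * u₁ + + 2 * S * u₂) * v₂) *
        ((+ 2 * P * u₁ + R * u₂) * v₁ + (R * u₁ + + 2 * S * u₂) * v₂) -
      + 4 * (P * u₁ * u₁ + R * u₁ * u₂ + S * u₂ * u₂) * (P * v₁ * v₁ + R * v₁ * v₂ + S * v₂ * v₂) ≡
      (R * R - + 4 * P * S) * ((u₁ * v₂ - u₂ * v₁) * (u₁ * v₂ - u₂ * v₁))
    identity = solve-∀

  B-det₂-cramer₁ : ∀ u h → + 2 * Q u * proj₁ h ≡
                           proj₁ u * B u h - (R * proj₁ u + + 2 * S * proj₂ u) * det₂ u h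
  B-det₂-cramer₁ (u₁ , u₂) (h₁ , h₂) = identity P R S u₁ u₂ h₁ h₂
    where
    identity : ∀ P R S u₁ u₂ h₁ h₂ →
      + 2 * (P * u₁ * u₁ + R * u₁ * u₂ + S * u₂ * u₂) * h₁ ≡
      u₁ * ((+ 2 * P * u₁ + R * u₂) * h₁ + (R * u₁ + + 2 * S * u₂) * h₂) -
        (R * u₁ + + 2 * S * u₂) * (u₁ * h₂ - u₂ * h₁)
    identity = solve-∀

  B-det₂-cramer₂ : ∀ u h → + 2 * Q u * proj₂ h ≡
                           proj₂ u * B u h + (+ 2 * P * proj₁ u + R * proj₂ u) * det₂ u h
  B-det₂-cramer₂ (u₁ , u₂) (h₁ , h₂) = identity P R S u₁ u₂ h₁ h₂
    where
    identity : ∀ P R S u₁ u₂ h₁ h₂ →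
      + 2 * (P * u₁ * u₁ + R * u₁ * u₂ + S * u₂ * u₂) * h₂ ≡
      u₂ * ((+ 2 * P * u₁ + R * u₂) * h₁ + (R * u₁ + + 2 * S * u₂) * h₂) +
        (+ 2 * P * u₁ + R * u₂) * (u₁ * h₂ - u₂ * h₁)
    identity = solve-∀

  module _ (m : ℕ) where

    open Congruence m
    open VectorCongruence m

    Q-cong : ∀ {u v} → u ≈ᵥ v → Q u ≈ Q v
    Q-cong {_ , _} {_ , _} (u₁≈v₁ , u₂≈v₂) =
      +-cong (+-cong (*-cong (*-congˡ P u₁≈v₁) u₁≈v₁) (*-cong (*-congˡ R u₁≈v₁) u₂≈v₂))
             (*-cong (*-congˡ S u₂≈v₂) u₂≈v₂)

    B-congˡ : ∀ {u u'} v → u ≈ᵥ u' → B u v ≈ B u' v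
    B-congˡ {_ , _} {_ , _} (v₁ , v₂) (u₁≈u₁' , u₂≈u₂') =
      +-cong (*-cong (+-cong (*-congˡ (+ 2 * P) u₁≈u₁') (*-congˡ R u₂≈u₂')) ≈-refl)
             (*-cong (+-cong (*-congˡ R u₁≈u₁') (*-congˡ (+ 2 * S) u₂≈u₂')) ≈-refl)

    B-sum-diff≈0 : ∀ {x y z w} → Q w ≈ Q z → x +ᵥ y ≈ᵥ z +ᵥ w → B (x +ᵥ y) (z -ᵥ w) ≈ 0ℤ
    B-sum-diff≈0 {x} {y} {z} {w} Qw≈Qz sum≈ = begin
      B (x +ᵥ y) (z -ᵥ w)  ≈⟨ B-congˡ (z -ᵥ w) sum≈ ⟩
      B (z +ᵥ w) (z -ᵥ w)  ≡⟨ B-sum-diff z w ⟩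
      + 2 * (Q z - Q w)    ≈⟨ *-congˡ (+ 2) (≈⇒-≈0 (≈-sym Qw≈Qz)) ⟩
      0ℤ                   ∎
      where open ≈-Reasoning

    B-sum-diffs-≈ : ∀ {x y z w} → Q y ≈ Q x → Q z ≈ Q x → Q w ≈ Q x → x +ᵥ y ≈ᵥ z +ᵥ w →
                    B (x +ᵥ y) (x -ᵥ y) ≈ B (x +ᵥ y) (z -ᵥ w)
    B-sum-diffs-≈ {x} {y} {z} {w} Qy≈Qx Qz≈Qx Qw≈Qx sum≈ =
      ≈-trans (B-sum-diff≈0 {x} {y} {x} {y} Qy≈Qx ≈ᵥ-refl)
              (≈-sym (B-sum-diff≈0 {x} {y} {z} {w} (≈-trans Qw≈Qx (≈-sym Qz≈Qx)) sum≈))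

    diff-values-≈ : ∀ {x y z w} → Q z ≈ Q x → Q w ≈ Q y → x +ᵥ y ≈ᵥ z +ᵥ w →
                    Q (x -ᵥ y) ≈ Q (z -ᵥ w)
    diff-values-≈ {x} {y} {z} {w} Qz≈Qx Qw≈Qy sum≈ = begin
      Q (x -ᵥ y)                      ≡⟨ parallelogram x y ⟩
      + 2 * (Q x + Q y) - Q (x +ᵥ y)  ≈⟨ -cong (*-congˡ (+ 2) (+-cong (≈-sym Qz≈Qx) (≈-sym Qw≈Qy)))
                                               (Q-cong sum≈) ⟩
      + 2 * (Q z + Q w) - Q (z +ᵥ w)  ≡⟨ sym (parallelogram z w) ⟩
      Q (z -ᵥ w)                      ∎
      where open ≈-Reasoning

  module OverOddPrime {p : ℕ} (p-prime : Prime p) (2≉0 : Congruence._≉_ p (+ 2) 0ℤ)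
                      (Δ≉0 : Congruence._≉_ p Δ 0ℤ) where

    open Congruence p
    open VectorCongruence p
    open PrimeCongruence p-prime

    B-det₂-injective : ∀ {u h h'} → Q u ≉ 0ℤ → B u h ≈ B u h' → det₂ u h ≈ det₂ u h' → h ≈ᵥ h'
    B-det₂-injective {u} {h} {h'} Qu≉0 B≈ det≈ =
      *-cancelˡ-≈ 2Qu≉0 (subst₂ _≈_ (sym (B-det₂-cramer₁ u h)) (sym (B-det₂-cramer₁ u h'))
                          (-cong (*-congˡ (proj₁ u) B≈) (*-congˡ (R * proj₁ u + + 2 * S * proj₂ u) det≈))) ,
      *-cancelˡ-≈ 2Qu≉0 (subst₂ _≈_ (sym (B-det₂-cramer₂ u h)) (sym (B-det₂-cramer₂ u h'))
                          (+-cong (*-congˡ (proj₂ u) B≈) (*-congˡ (+ 2 * P * proj₁ u + R * proj₂ u) det≈)))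
      where
      2Qu≉0 : + 2 * Q u ≉ 0ℤ
      2Qu≉0 = *-≉0 2≉0 Qu≉0

    halvesᵥ : ∀ {x y z w} → x +ᵥ y ≈ᵥ z +ᵥ w → x -ᵥ y ≈ᵥ z -ᵥ w → x ≈ᵥ z × y ≈ᵥ w
    halvesᵥ (sum≈₁ , sum≈₂) (diff≈₁ , diff≈₂) =
      let (x₁≈z₁ , y₁≈w₁) = halves 2≉0 sum≈₁ diff≈₁
          (x₂≈z₂ , y₂≈w₂) = halves 2≉0 sum≈₂ diff≈₂
      in (x₁≈z₁ , x₂≈z₂) , (y₁≈w₁ , y₂≈w₂)

    isotropic-sum⇒≈0 : ∀ {x y} → Q x ≉ 0ℤ → Q y ≈ Q x → Q (x +ᵥ y) ≈ 0ℤ → x +ᵥ y ≈ᵥ 0ᵥ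
    isotropic-sum⇒≈0 {x} {y} Qx≉0 Qy≈Qx Qs≈0 =
      B-det₂-injective {e} {s} {0ᵥ} Qe≉0 (subst (B e s ≈_) (sym (B-zeroʳ e)) Bes≈0)
                                         (subst (det₂ e s ≈_) (sym (det₂-zeroʳ e)) dets≈0)
      where
      s e : V2
      s = x +ᵥ y
      e = x -ᵥ y
      Bes≈0 : B e s ≈ 0ℤ
      Bes≈0 = subst (_≈ 0ℤ) (B-sym s e) (B-sum-diff≈0 p {x} {y} {x} {y} Qy≈Qx ≈ᵥ-refl)
      Qe≈4Qx : Q e ≈ + 4 * Q x
      Qe≈4Qx = begin
        Q e                      ≡⟨ parallelogram x y ⟩
        + 2 * (Q x + Q y) - Q s  ≈⟨ -cong (*-congˡ (+ 2) (+-cong (≈-refl {Q x}) Qy≈Qx)) Qs≈0 ⟩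
        + 2 * (Q x + Q x) - 0ℤ   ≡⟨ identity (Q x) ⟩
        + 4 * Q x                ∎
        where
        open ≈-Reasoning
        identity : ∀ q → + 2 * (q + q) - 0ℤ ≡ + 4 * q
        identity = solve-∀
      Qe≉0 : Q e ≉ 0ℤ
      Qe≉0 Qe≈0 = *-≉0 (*-≉0 2≉0 2≉0) Qx≉0 (≈-trans (≈-sym Qe≈4Qx) Qe≈0)
      dets≈0 : det₂ e s ≈ 0ℤ
      dets≈0 = square-≈0 (*-≈0-cancelˡ Δ≉0 (begin
        Δ * (det₂ e s * det₂ e s)        ≡⟨ sym (B-discriminant e s) ⟩
        B e s * B e s - + 4 * Q e * Q s  ≈⟨ -cong (*-cong Bes≈0 Bes≈0) (*-congˡ (+ 4 * Q e) Qs≈0) ⟩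
        0ℤ * 0ℤ - + 4 * Q e * 0ℤ         ≡⟨ identity (Q e) ⟩
        0ℤ                               ∎))
        where
        open ≈-Reasoning
        identity : ∀ q → 0ℤ * 0ℤ - + 4 * q * 0ℤ ≡ 0ℤ
        identity = solve-∀

    det₂-squares-≈ : ∀ {x y z w} → Q y ≈ Q x → Q z ≈ Q x → Q w ≈ Q x → x +ᵥ y ≈ᵥ z +ᵥ w →
                     det₂ (x +ᵥ y) (x -ᵥ y) * det₂ (x +ᵥ y) (x -ᵥ y) ≈
                     det₂ (x +ᵥ y) (z -ᵥ w) * det₂ (x +ᵥ y) (z -ᵥ w)
    det₂-squares-≈ {x} {y} {z} {w} Qy≈Qx Qz≈Qx Qw≈Qx sum≈ = *-cancelˡ-≈ Δ≉0 (begin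
      Δ * (det₂ s e * det₂ s e)        ≡⟨ sym (B-discriminant s e) ⟩
      B s e * B s e - + 4 * Q s * Q e  ≈⟨ -cong (*-cong Bse≈Bsf Bse≈Bsf) (*-congˡ (+ 4 * Q s) Qe≈Qf) ⟩
      B s f * B s f - + 4 * Q s * Q f  ≡⟨ B-discriminant s f ⟩
      Δ * (det₂ s f * det₂ s f)        ∎)
      where
      open ≈-Reasoning
      s e f : V2
      s = x +ᵥ y
      e = x -ᵥ y
      f = z -ᵥ w
      Bse≈Bsf : B s e ≈ B s f
      Bse≈Bsf = B-sum-diffs-≈ p {x} {y} {z} {w} Qy≈Qx Qz≈Qx Qw≈Qx sum≈
      Qe≈Qf : Q e ≈ Q f
      Qe≈Qf = diff-values-≈ p Qz≈Qx (≈-trans Qw≈Qx (≈-sym Qy≈Qx)) sum≈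

    anisotropic-sum⇒matching :
      ∀ {x y z w} → Q (x +ᵥ y) ≉ 0ℤ → Q y ≈ Q x → Q z ≈ Q x → Q w ≈ Q x → x +ᵥ y ≈ᵥ z +ᵥ w →
      det₂ (x +ᵥ y) (x -ᵥ y) ≈ det₂ (x +ᵥ y) (z -ᵥ w) → x ≈ᵥ z × y ≈ᵥ w
    anisotropic-sum⇒matching {x} {y} {z} {w} Qs≉0 Qy≈Qx Qz≈Qx Qw≈Qx sum≈ det≈ =
      halvesᵥ sum≈ (B-det₂-injective {x +ᵥ y} {x -ᵥ y} {z -ᵥ w} Qs≉0
                      (B-sum-diffs-≈ p {x} {y} {z} {w} Qy≈Qx Qz≈Qx Qw≈Qx sum≈) det≈)

    -- With s = x + y, both x − y and z − w are B-orthogonal to s and have the same Q-value, so by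
    -- B-discriminant their det₂ with s agree up to sign; when Q s ≢ 0 this pins down x − y = ±(z − w).
    equal-sums-of-equal-values :
      ∀ {x y z w} → Q x ≉ 0ℤ → Q y ≈ Q x → Q z ≈ Q x → Q w ≈ Q x → x +ᵥ y ≈ᵥ z +ᵥ w →
      (x ≈ᵥ z × y ≈ᵥ w) ⊎ (x ≈ᵥ w × y ≈ᵥ z) ⊎ (x +ᵥ y ≈ᵥ 0ᵥ × z +ᵥ w ≈ᵥ 0ᵥ)
    equal-sums-of-equal-values {x} {y} {z} {w} Qx≉0 Qy≈Qx Qz≈Qx Qw≈Qx sum≈ =
      by-isotropy (Q s ≈? 0ℤ)
      where
      s = x +ᵥ y
      by-isotropy : Dec (Q s ≈ 0ℤ) →
                    (x ≈ᵥ z × y ≈ᵥ w) ⊎ (x ≈ᵥ w × y ≈ᵥ z) ⊎ (s ≈ᵥ 0ᵥ × z +ᵥ w ≈ᵥ 0ᵥ)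
      by-isotropy (yes Qs≈0) = inj₂ (inj₂ (s≈0 , ≈ᵥ-trans (≈ᵥ-sym sum≈) s≈0))
        where
        s≈0 = isotropic-sum⇒≈0 {x} {y} Qx≉0 Qy≈Qx Qs≈0
      by-isotropy (no Qs≉0) =
        by-sign (square-≈ (det₂-squares-≈ {x} {y} {z} {w} Qy≈Qx Qz≈Qx Qw≈Qx sum≈))
        where
        by-sign : det₂ s (x -ᵥ y) ≈ det₂ s (z -ᵥ w) ⊎ det₂ s (x -ᵥ y) ≈ - det₂ s (z -ᵥ w) →
                  (x ≈ᵥ z × y ≈ᵥ w) ⊎ (x ≈ᵥ w × y ≈ᵥ z) ⊎ (s ≈ᵥ 0ᵥ × z +ᵥ w ≈ᵥ 0ᵥ)
        by-sign (inj₁ det≈) =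
          inj₁ (anisotropic-sum⇒matching {x} {y} {z} {w} Qs≉0 Qy≈Qx Qz≈Qx Qw≈Qx sum≈ det≈)
        by-sign (inj₂ det≈-) =
          inj₂ (inj₁ (anisotropic-sum⇒matching {x} {y} {w} {z} Qs≉0 Qy≈Qx Qw≈Qx Qz≈Qx
                        (≈ᵥ-trans sum≈ (+ᵥ-comm z w))
                        (subst (det₂ s (x -ᵥ y) ≈_) (sym (det₂-swap s z w)) det≈-)))

module _ where

  open import Data.Integer using (_+_; _*_)

  mat-≡ : ∀ {a₁ b₁ c₁ d₁ a₂ b₂ c₂ d₂} → a₁ ≡ a₂ → b₁ ≡ b₂ → c₁ ≡ c₂ → d₁ ≡ d₂ →
          mat a₁ b₁ c₁ d₁ ≡ mat a₂ b₂ c₂ d₂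
  mat-≡ refl refl refl refl = refl

  row-matrix-column-assoc : ∀ u₁ u₂ x₁₁ x₁₂ x₂₁ x₂₂ v₁ v₂ →
    (u₁ * x₁₁ + u₂ * x₂₁) * v₁ + (u₁ * x₁₂ + u₂ * x₂₂) * v₂ ≡
    u₁ * (x₁₁ * v₁ + x₁₂ * v₂) + u₂ * (x₂₁ * v₁ + x₂₂ * v₂)
  row-matrix-column-assoc = solve-∀

  ⊗-assoc : ∀ X Y Z → (X ⊗ Y) ⊗ Z ≡ X ⊗ (Y ⊗ Z)
  ⊗-assoc (mat a₁ b₁ c₁ d₁) (mat a₂ b₂ c₂ d₂) (mat a₃ b₃ c₃ d₃) =
    mat-≡ (row-matrix-column-assoc a₁ b₁ a₂ b₂ c₂ d₂ a₃ c₃)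
          (row-matrix-column-assoc a₁ b₁ a₂ b₂ c₂ d₂ b₃ d₃)
          (row-matrix-column-assoc c₁ d₁ a₂ b₂ c₂ d₂ a₃ c₃)
          (row-matrix-column-assoc c₁ d₁ a₂ b₂ c₂ d₂ b₃ d₃)

  ·-⊗ : ∀ u X Y → u · (X ⊗ Y) ≡ (u · X) · Y
  ·-⊗ (u₁ , u₂) (mat a₁ b₁ c₁ d₁) (mat a₂ b₂ c₂ d₂) =
    cong₂ _,_ (sym (row-matrix-column-assoc u₁ u₂ a₁ b₁ c₁ d₁ a₂ c₂))
              (sym (row-matrix-column-assoc u₁ u₂ a₁ b₁ c₁ d₁ b₂ d₂))

  unit-first : ∀ x y → x * 1ℤ + y * 0ℤ ≡ x
  unit-first = solve-∀

  unit-second : ∀ x y → x * 0ℤ + y * 1ℤ ≡ y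
  unit-second = solve-∀

  ⊗-identityˡ : ∀ X → I₂ ⊗ X ≡ X
  ⊗-identityˡ (mat a₁ b₁ c₁ d₁) = mat-≡ (first a₁ c₁) (first b₁ d₁) (second a₁ c₁) (second b₁ d₁)
    where
    first : ∀ x y → 1ℤ * x + 0ℤ * y ≡ x
    first = solve-∀
    second : ∀ x y → 0ℤ * x + 1ℤ * y ≡ y
    second = solve-∀

  ⊗-identityʳ : ∀ X → X ⊗ I₂ ≡ X
  ⊗-identityʳ (mat a₁ b₁ c₁ d₁) =
    mat-≡ (unit-first a₁ b₁) (unit-second a₁ b₁) (unit-first c₁ d₁) (unit-second c₁ d₁)

  ·-identityʳ : ∀ u → u · I₂ ≡ u
  ·-identityʳ (u₁ , u₂) = cong₂ _,_ (unit-first u₁ u₂) (unit-second u₁ u₂)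

-- The form u ↦ det₂ u (u · A); its discriminant is tr(A)² − 4 det A.
module InvariantForm (A : M2) where

  open import Data.Integer using (_+_; _-_; _*_; -_)
  open BinaryQuadraticForm (b A) (d A - a A) (- c A) public

  Q-· : ∀ u → Q (u · A) ≡ det A * Q u
  Q-· (u₁ , u₂) = identity (a A) (b A) (c A) (d A) u₁ u₂
    where
    identity : ∀ a₀ b₀ c₀ d₀ u₁ u₂ →
      b₀ * (u₁ * a₀ + u₂ * c₀) * (u₁ * a₀ + u₂ * c₀) +
        (d₀ - a₀) * (u₁ * a₀ + u₂ * c₀) * (u₁ * b₀ + u₂ * d₀) +
        - c₀ * (u₁ * b₀ + u₂ * d₀) * (u₁ * b₀ + u₂ * d₀) ≡
      (a₀ * d₀ - b₀ * c₀) * (b₀ * u₁ * u₁ + (d₀ - a₀) * u₁ * u₂ + - c₀ * u₂ * u₂)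
    identity = solve-∀

  Q≡det₂ : ∀ u → Q u ≡ det₂ u (u · A)
  Q≡det₂ (u₁ , u₂) = identity (a A) (b A) (c A) (d A) u₁ u₂
    where
    identity : ∀ a₀ b₀ c₀ d₀ u₁ u₂ →
      b₀ * u₁ * u₁ + (d₀ - a₀) * u₁ * u₂ + - c₀ * u₂ * u₂ ≡
      u₁ * (u₁ * b₀ + u₂ * d₀) - u₂ * (u₁ * a₀ + u₂ * c₀)
    identity = solve-∀

  module _ (det≡1 : det A ≡ 1ℤ) where

    Q-^^ : ∀ x u → Q (u · (A ^^ x)) ≡ Q u
    Q-^^ zero u = cong Q (·-identityʳ u)
    Q-^^ (suc x) u = begin
      Q (u · (A ⊗ (A ^^ x)))  ≡⟨ cong Q (·-⊗ u A (A ^^ x)) ⟩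
      Q ((u · A) · (A ^^ x))  ≡⟨ Q-^^ x (u · A) ⟩
      Q (u · A)               ≡⟨ Q-· u ⟩
      det A * Q u             ≡⟨ cong (_* Q u) det≡1 ⟩
      1ℤ * Q u                ≡⟨ ℤₚ.*-identityˡ (Q u) ⟩
      Q u                     ∎
      where open ≡-Reasoning

    disc≡4Δ : disc A ≡ + 4 * Δ
    disc≡4Δ = begin
      disc A                         ≡⟨ identity (a A) (b A) (c A) (d A) ⟩
      + 4 * Δ + + 16 * (det A - 1ℤ)  ≡⟨ cong (λ δ → + 4 * Δ + + 16 * (δ - 1ℤ)) det≡1 ⟩
      + 4 * Δ + 0ℤ                   ≡⟨ ℤₚ.+-identityʳ (+ 4 * Δ) ⟩
      + 4 * Δ                        ∎
      where
      open ≡-Reasoning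
      identity : ∀ a₀ b₀ c₀ d₀ →
        + 4 * ((a₀ + d₀) * (a₀ + d₀) - + 4) ≡
        + 4 * ((d₀ - a₀) * (d₀ - a₀) - + 4 * b₀ * - c₀) + + 16 * ((a₀ * d₀ - b₀ * c₀) - 1ℤ)
      identity = solve-∀

    module ModuloPrime {p : ℕ} (p-prime : Prime p) (p∤disc : ¬ p ∣ ∣ disc A ∣) where

      open Congruence p
      open PrimeCongruence p-prime

      4Δ≉0 : + 4 * Δ ≉ 0ℤ
      4Δ≉0 4Δ≈0 = p∤disc (∣⇒∣ᵤ (≈0⇒∣ (subst (_≈ 0ℤ) (sym disc≡4Δ) 4Δ≈0)))

      2≉0 : + 2 ≉ 0ℤ
      2≉0 2≈0 = 4Δ≉0 (subst (_≈ 0ℤ) (trans (ℤₚ.*-comm (+ 2 * Δ) (+ 2)) (sym (ℤₚ.*-assoc (+ 2) (+ 2) Δ)))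
                             (≈0-*ˡ (+ 2 * Δ) 2≈0))

      Δ≉0 : Δ ≉ 0ℤ
      Δ≉0 Δ≈0 = 4Δ≉0 (≈0-*ˡ (+ 4) Δ≈0)

module MatrixCongruence (m : ℕ) where

  open Congruence m
  open VectorCongruence m

  infix 4 _≈ₘ_

  record _≈ₘ_ (X Y : M2) : Set where
    constructor ≈ₘ-intro
    field
      a≈ : a X ≈ a Y
      b≈ : b X ≈ b Y
      c≈ : c X ≈ c Y
      d≈ : d X ≈ d Y

  from-modM : ∀ {X Y} → X ≡M Y [modM m ] → X ≈ₘ Y
  from-modM (a≡ , b≡ , c≡ , d≡) = ≈ₘ-intro (from-mod a≡) (from-mod b≡) (from-mod c≡) (from-mod d≡)

  to-modM : ∀ {X Y} → X ≈ₘ Y → X ≡M Y [modM m ]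
  to-modM (≈ₘ-intro a≈ b≈ c≈ d≈) = to-mod a≈ , to-mod b≈ , to-mod c≈ , to-mod d≈

  _≈ₘ?_ : ∀ X Y → Dec (X ≈ₘ Y)
  X ≈ₘ? Y = map′ from-modM to-modM
    ((a X ≡? a Y [mod m ]) ×-dec (b X ≡? b Y [mod m ]) ×-dec
     (c X ≡? c Y [mod m ]) ×-dec (d X ≡? d Y [mod m ]))

  ≈ₘ-reflexive : ∀ {X Y} → X ≡ Y → X ≈ₘ Y
  ≈ₘ-reflexive refl = ≈ₘ-intro ≈-refl ≈-refl ≈-refl ≈-refl

  ≈ₘ-refl : ∀ {X} → X ≈ₘ X
  ≈ₘ-refl = ≈ₘ-reflexive refl

  ≈ₘ-sym : ∀ {X Y} → X ≈ₘ Y → Y ≈ₘ X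
  ≈ₘ-sym (≈ₘ-intro a≈ b≈ c≈ d≈) = ≈ₘ-intro (≈-sym a≈) (≈-sym b≈) (≈-sym c≈) (≈-sym d≈)

  ≈ₘ-trans : ∀ {X Y Z} → X ≈ₘ Y → Y ≈ₘ Z → X ≈ₘ Z
  ≈ₘ-trans (≈ₘ-intro a≈ b≈ c≈ d≈) (≈ₘ-intro a≈' b≈' c≈' d≈') =
    ≈ₘ-intro (≈-trans a≈ a≈') (≈-trans b≈ b≈') (≈-trans c≈ c≈') (≈-trans d≈ d≈')

  ≈ₘ-setoid : Setoid _ _
  ≈ₘ-setoid = record
    { Carrier = M2
    ; _≈_ = _≈ₘ_
    ; isEquivalence = record { refl = ≈ₘ-refl ; sym = ≈ₘ-sym ; trans = ≈ₘ-trans }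
    }

  module ≈ₘ-Reasoning = SetoidReasoning ≈ₘ-setoid

  ⊗-cong : ∀ {X X' Y Y'} → X ≈ₘ X' → Y ≈ₘ Y' → X ⊗ Y ≈ₘ X' ⊗ Y'
  ⊗-cong {mat _ _ _ _} {mat _ _ _ _} {mat _ _ _ _} {mat _ _ _ _}
         (≈ₘ-intro a≈ b≈ c≈ d≈) (≈ₘ-intro a≈' b≈' c≈' d≈') =
    ≈ₘ-intro (+-cong (*-cong a≈ a≈') (*-cong b≈ c≈')) (+-cong (*-cong a≈ b≈') (*-cong b≈ d≈'))
             (+-cong (*-cong c≈ a≈') (*-cong d≈ c≈')) (+-cong (*-cong c≈ b≈') (*-cong d≈ d≈'))

  ·-cong : ∀ {u u' X X'} → u ≈ᵥ u' → X ≈ₘ X' → u · X ≈ᵥ u' · X'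
  ·-cong {_ , _} {_ , _} {mat _ _ _ _} {mat _ _ _ _} (u₁≈ , u₂≈) (≈ₘ-intro a≈ b≈ c≈ d≈) =
    +-cong (*-cong u₁≈ a≈) (*-cong u₂≈ c≈) , +-cong (*-cong u₁≈ b≈) (*-cong u₂≈ d≈)

module PrimeMatrixCongruence {p : ℕ} (p-prime : Prime p) where

  open import Data.Integer using (_+_; _-_; _*_; -_)
  open Congruence p
  open VectorCongruence p
  open MatrixCongruence p
  open PrimeCongruence p-prime

  -- If det₂ w u ≡ 0 then (w₁, −u₁) and (w₂, −u₂) are relations, so w ≡ 0 and (0, 1) is a relation.
  independent⇒det₂≉0 : ∀ {u w} → LinIndepMod p u w → det₂ w u ≉ 0ℤ
  independent⇒det₂≉0 {u₁ , u₂} {w₁ , w₂} independent D≈0 =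
    1≉0 (proj₂ (relation 0ℤ 1ℤ (via (only-second u₁ w₁) w₁≈0) (via (only-second u₂ w₂) w₂≈0)))
    where
    relation : ∀ s t → s * u₁ + t * w₁ ≈ 0ℤ → s * u₂ + t * w₂ ≈ 0ℤ → s ≈ 0ℤ × t ≈ 0ℤ
    relation s t r₁ r₂ = let (s≡0 , t≡0) = independent s t (to-mod r₁) (to-mod r₂)
                         in from-mod s≡0 , from-mod t≡0
    via : ∀ {x y} → x ≡ y → y ≈ 0ℤ → x ≈ 0ℤ
    via x≡y = subst (_≈ 0ℤ) (sym x≡y)
    cancels : ∀ x y → x * y + - y * x ≡ 0ℤ
    cancels = solve-∀
    only-second : ∀ x y → 0ℤ * x + 1ℤ * y ≡ y
    only-second = solve-∀
    first-relation : ∀ w₁ w₂ u₁ u₂ → w₁ * u₂ + - u₁ * w₂ ≡ w₁ * u₂ - w₂ * u₁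
    first-relation = solve-∀
    second-relation : ∀ w₁ w₂ u₁ u₂ → w₂ * u₁ + - u₂ * w₁ ≡ - (w₁ * u₂ - w₂ * u₁)
    second-relation = solve-∀
    w₁≈0 : w₁ ≈ 0ℤ
    w₁≈0 = proj₁ (relation w₁ (- u₁) (≈-reflexive (cancels w₁ u₁))
                                     (via (first-relation w₁ w₂ u₁ u₂) D≈0))
    w₂≈0 : w₂ ≈ 0ℤ
    w₂≈0 = proj₁ (relation w₂ (- u₂) (via (second-relation w₁ w₂ u₁ u₂) (-‿cong D≈0))
                                     (≈-reflexive (cancels w₂ u₂)))

  column-determined : ∀ {u w x z x' z'} → det₂ u w ≉ 0ℤ →
                      proj₁ u * x + proj₂ u * z ≈ proj₁ u * x' + proj₂ u * z' →
                      proj₁ w * x + proj₂ w * z ≈ proj₁ w * x' + proj₂ w * z' →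
                      x ≈ x' × z ≈ z'
  column-determined {u₁ , u₂} {w₁ , w₂} {x} {z} {x'} {z'} D≉0 u≈ w≈ =
    *-cancelˡ-≈ D≉0 (subst₂ _≈_ (eliminate-z u₁ u₂ w₁ w₂ x z) (eliminate-z u₁ u₂ w₁ w₂ x' z')
                       (-cong (*-congˡ w₂ u≈) (*-congˡ u₂ w≈))) ,
    *-cancelˡ-≈ D≉0 (subst₂ _≈_ (eliminate-x u₁ u₂ w₁ w₂ x z) (eliminate-x u₁ u₂ w₁ w₂ x' z')
                       (-cong (*-congˡ u₁ w≈) (*-congˡ w₁ u≈)))
    where
    eliminate-z : ∀ u₁ u₂ w₁ w₂ x z →
      w₂ * (u₁ * x + u₂ * z) - u₂ * (w₁ * x + w₂ * z) ≡ (u₁ * w₂ - u₂ * w₁) * x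
    eliminate-z = solve-∀
    eliminate-x : ∀ u₁ u₂ w₁ w₂ x z →
      u₁ * (w₁ * x + w₂ * z) - w₁ * (u₁ * x + u₂ * z) ≡ (u₁ * w₂ - u₂ * w₁) * z
    eliminate-x = solve-∀

  rows-determine : ∀ {u w X Y} → det₂ u w ≉ 0ℤ → u · X ≈ᵥ u · Y → w · X ≈ᵥ w · Y → X ≈ₘ Y
  rows-determine {u} {w} {mat _ _ _ _} {mat _ _ _ _} D≉0 (u≈₁ , u≈₂) (w≈₁ , w≈₂) =
    let (a≈ , c≈) = column-determined {u} {w} D≉0 u≈₁ w≈₁
        (b≈ , d≈) = column-determined {u} {w} D≉0 u≈₂ w≈₂
    in ≈ₘ-intro a≈ b≈ c≈ d≈

≈-divisor : ∀ {d m x y} → d ∣ m → Congruence._≈_ m x y → Congruence._≈_ d x y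
≈-divisor d∣m (Congruence.from-mod m∣x-y) = Congruence.from-mod (∣-trans d∣m m∣x-y)

≈ₘ-divisor : ∀ {d m X Y} → d ∣ m → MatrixCongruence._≈ₘ_ m X Y → MatrixCongruence._≈ₘ_ d X Y
≈ₘ-divisor d∣m (MatrixCongruence.≈ₘ-intro a≈ b≈ c≈ d≈) =
  MatrixCongruence.≈ₘ-intro (≈-divisor d∣m a≈) (≈-divisor d∣m b≈) (≈-divisor d∣m c≈) (≈-divisor d∣m d≈)

open import Data.Nat using (_+_; _*_; _^_; _≤_; _<_)

^^-+ : ∀ A x y → A ^^ (x + y) ≡ (A ^^ x) ⊗ (A ^^ y)
^^-+ A zero y = sym (⊗-identityˡ (A ^^ y))
^^-+ A (suc x) y = trans (cong (A ⊗_) (^^-+ A x y)) (sym (⊗-assoc A (A ^^ x) (A ^^ y)))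

⊗-^^-comm : ∀ A x → A ⊗ (A ^^ x) ≡ (A ^^ x) ⊗ A
⊗-^^-comm A x = begin
  A ^^ (1 + x)         ≡⟨ cong (A ^^_) (ℕₚ.+-comm 1 x) ⟩
  A ^^ (x + 1)         ≡⟨ ^^-+ A x 1 ⟩
  (A ^^ x) ⊗ (A ⊗ I₂)  ≡⟨ cong ((A ^^ x) ⊗_) (⊗-identityʳ A) ⟩
  (A ^^ x) ⊗ A         ∎
  where open ≡-Reasoning

prime∤⇒coprime : ∀ {q n} → Prime q → ¬ q ∣ n → Coprime q n
prime∤⇒coprime q-prime q∤n (d∣q , d∣n) with prime⇒irreducible q-prime d∣q
... | inj₁ d≡1 = d≡1
... | inj₂ refl = contradiction d∣n q∤n

coprime-∣⇒*∣ : ∀ {q n x} → Coprime q n → q ∣ x → n ∣ x → q * n ∣ x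
coprime-∣⇒*∣ {q} {n} coprime q∣x (divides k refl) =
  *-monoˡ-∣ n (coprime-divisor coprime (subst (q ∣_) (ℕₚ.*-comm k n) q∣x))

product-∣ : ∀ {N x} → Squarefree N → (∀ p → Prime p → p ∣ N → p ∣ x) →
            ∀ fs → All Prime fs → product fs ∣ N → product fs ∣ x
product-∣ {N} {x} _ _ [] [] _ = 1∣ x
product-∣ {N} {x} sqf prime∣x (q ∷ fs) (q-prime ∷ fs-prime) q*fs∣N =
  coprime-∣⇒*∣ (prime∤⇒coprime q-prime q∤fs)
               (prime∣x q q-prime (∣-trans (m∣m*n (product fs)) q*fs∣N))
               (product-∣ sqf prime∣x fs fs-prime (∣-trans (n∣m*n q) q*fs∣N))
  where
  q∤fs : ¬ q ∣ product fs
  q∤fs q∣fs = sqf q q-prime (∣-trans (*-monoʳ-∣ q q∣fs) q*fs∣N)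

squarefree⇒∣ : ∀ {N x} .{{_ : NonZero N}} → Squarefree N → (∀ p → Prime p → p ∣ N → p ∣ x) → N ∣ x
squarefree⇒∣ {N} sqf prime∣x =
  subst (_∣ _) (sym N≡∏) (product-∣ sqf prime∣x factors factorsPrime (∣-reflexive (sym N≡∏)))
  where
  open PrimeFactorisation (factorise N) renaming (isFactorisation to N≡∏)

module _ {N : ℕ} .{{_ : NonZero N}} (sqf : Squarefree N) where

  ≈-squarefree : ∀ {x y} → (∀ p → Prime p → p ∣ N → Congruence._≈_ p x y) → Congruence._≈_ N x y
  ≈-squarefree x≈y = Congruence.from-mod (squarefree⇒∣ sqf (λ p p-prime p∣N →
                       Congruence.to-mod (x≈y p p-prime p∣N)))

  ≈ₘ-squarefree : ∀ {X Y} → (∀ p → Prime p → p ∣ N → MatrixCongruence._≈ₘ_ p X Y) →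
                  MatrixCongruence._≈ₘ_ N X Y
  ≈ₘ-squarefree X≈Y = MatrixCongruence.≈ₘ-intro
    (≈-squarefree (λ p p-prime p∣N → MatrixCongruence._≈ₘ_.a≈ (X≈Y p p-prime p∣N)))
    (≈-squarefree (λ p p-prime p∣N → MatrixCongruence._≈ₘ_.b≈ (X≈Y p p-prime p∣N)))
    (≈-squarefree (λ p p-prime p∣N → MatrixCongruence._≈ₘ_.c≈ (X≈Y p p-prime p∣N)))
    (≈-squarefree (λ p p-prime p∣N → MatrixCongruence._≈ₘ_.d≈ (X≈Y p p-prime p∣N)))

module Powers (A : M2) where

  infix 4 _~[_]_

  record _~[_]_ (x m y : ℕ) : Set where
    constructor ~-intro
    field ~-elim : MatrixCongruence._≈ₘ_ m (A ^^ x) (A ^^ y)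
  open _~[_]_ public

  _~[_]?_ : ∀ x m y → Dec (x ~[ m ] y)
  x ~[ m ]? y = map′ ~-intro ~-elim (MatrixCongruence._≈ₘ?_ m (A ^^ x) (A ^^ y))

  module _ {m : ℕ} where

    open MatrixCongruence m

    ~-refl : ∀ {x} → x ~[ m ] x
    ~-refl = ~-intro ≈ₘ-refl

    ~-sym : ∀ {x y} → x ~[ m ] y → y ~[ m ] x
    ~-sym (~-intro x≈y) = ~-intro (≈ₘ-sym x≈y)

    ~-trans : ∀ {x y z} → x ~[ m ] y → y ~[ m ] z → x ~[ m ] z
    ~-trans (~-intro x≈y) (~-intro y≈z) = ~-intro (≈ₘ-trans x≈y y≈z)

    ~-reflexive : ∀ {x y} → x ≡ y → x ~[ m ] y
    ~-reflexive refl = ~-refl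

    ~-+ˡ : ∀ t {x y} → x ~[ m ] y → t + x ~[ m ] t + y
    ~-+ˡ t {x} {y} (~-intro x≈y) = ~-intro (begin
      A ^^ (t + x)         ≡⟨ ^^-+ A t x ⟩
      (A ^^ t) ⊗ (A ^^ x)  ≈⟨ ⊗-cong (≈ₘ-refl {A ^^ t}) x≈y ⟩
      (A ^^ t) ⊗ (A ^^ y)  ≡⟨ sym (^^-+ A t y) ⟩
      A ^^ (t + y)         ∎)
      where open ≈ₘ-Reasoning

    ~-+ʳ : ∀ t {x y} → x ~[ m ] y → x + t ~[ m ] y + t
    ~-+ʳ t {x} {y} x~y = subst₂ (_~[ m ]_) (ℕₚ.+-comm t x) (ℕₚ.+-comm t y) (~-+ˡ t x~y)

    module Periodic {K : ℕ} (A^K≈I : (A ^^ K) ≈ₘ I₂) where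

      ~-period : ∀ x → K + x ~[ m ] x
      ~-period x = ~-intro (begin
        A ^^ (K + x)         ≡⟨ ^^-+ A K x ⟩
        (A ^^ K) ⊗ (A ^^ x)  ≈⟨ ⊗-cong A^K≈I (≈ₘ-refl {A ^^ x}) ⟩
        I₂ ⊗ (A ^^ x)        ≡⟨ ⊗-identityˡ (A ^^ x) ⟩
        A ^^ x               ∎)
        where open ≈ₘ-Reasoning

      ~-cancelˡ : ∀ {t x y} → t ≤ K → t + x ~[ m ] t + y → x ~[ m ] y
      ~-cancelˡ {t} {x} {y} t≤K t+x~t+y =
        ~-trans (~-sym (~-period x))
          (~-trans (subst₂ (_~[ m ]_) (complete x) (complete y) (~-+ˡ (K ∸ t) t+x~t+y))
                   (~-period y))
        where
        complete : ∀ z → K ∸ t + (t + z) ≡ K + z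
        complete z = trans (sym (ℕₚ.+-assoc (K ∸ t) t z)) (cong (_+ z) (ℕₚ.m∸n+n≡m t≤K))

count : ∀ {A : Set} {P : Pred A 0ℓ} → Decidable P → List A → ℕ
count P? xs = length (filter P? xs)

count-cons : ∀ {A : Set} {P : Pred A 0ℓ} (P? : Decidable P) x xs → count P? xs ≤ count P? (x ∷ xs)
count-cons P? x xs with P? x
... | yes _ = ℕₚ.n≤1+n _
... | no _ = ℕₚ.≤-refl

count-accept : ∀ {A : Set} {P : Pred A 0ℓ} (P? : Decidable P) {x xs} → P x →
               count P? (x ∷ xs) ≡ suc (count P? xs)
count-accept P? Px = cong length (filter-accept P? Px)

module _ {A : Set} {P : Pred A 0ℓ} (P? : Decidable P) where

  count-none : ∀ {xs} → All (∁ P) xs → count P? xs ≡ 0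
  count-none ¬Pxs = cong length (filter-none P? ¬Pxs)

  count-++ : ∀ xs ys → count P? (xs ++ ys) ≡ count P? xs + count P? ys
  count-++ xs ys = trans (cong length (filter-++ P? xs ys)) (length-++ (filter P? xs))

  count-concatMap : ∀ {B : Set} (f : B → List A) xs →
                    count P? (concatMap f xs) ≡ sum (map (count P? ∘ f) xs)
  count-concatMap f [] = refl
  count-concatMap f (x ∷ xs) =
    trans (count-++ (f x) (concatMap f xs)) (cong (_+_ (count P? (f x))) (count-concatMap f xs))

  count-map : ∀ {B : Set} (g : B → A) xs → count P? (map g xs) ≡ count (P? ∘ g) xs
  count-map g [] = refl
  count-map g (x ∷ xs) with P? (g x)
  ... | yes _ = cong suc (count-map g xs)
  ... | no _ = count-map g xs

  count-≤-from-witness : ∀ {xs c} → (∀ {x₀} → x₀ ∈ xs → P x₀ → count P? xs ≤ c) →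
                         count P? xs ≤ c
  count-≤-from-witness {xs} bound with any? P? xs
  ... | yes ∃P = let (x₀ , x₀∈xs , Px₀) = find ∃P in bound x₀∈xs Px₀
  ... | no ∄P = ℕₚ.≤-trans (ℕₚ.≤-reflexive (count-none (¬Any⇒All¬ xs ∄P))) z≤n

  count-mono : ∀ {Q : Pred A 0ℓ} (Q? : Decidable Q) → (∀ {x} → P x → Q x) →
               ∀ xs → count P? xs ≤ count Q? xs
  count-mono Q? P⇒Q [] = z≤n
  count-mono Q? P⇒Q (x ∷ xs) with P? x | Q? x
  ... | yes _  | yes _  = s≤s (count-mono Q? P⇒Q xs)
  ... | yes Px | no ¬Qx = contradiction (P⇒Q Px) ¬Qx
  ... | no _   | yes _  = ℕₚ.m≤n⇒m≤1+n (count-mono Q? P⇒Q xs)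
  ... | no _   | no _   = count-mono Q? P⇒Q xs

  count-⊎ : ∀ {Q R : Pred A 0ℓ} (Q? : Decidable Q) (R? : Decidable R) →
            (∀ {x} → P x → Q x ⊎ R x) → ∀ xs → count P? xs ≤ count Q? xs + count R? xs
  count-⊎ Q? R? P⇒Q⊎R [] = z≤n
  count-⊎ Q? R? P⇒Q⊎R (x ∷ xs) with P? x
  ... | no _ = ℕₚ.≤-trans ih (ℕₚ.+-mono-≤ (count-cons Q? x xs) (count-cons R? x xs))
    where ih = count-⊎ Q? R? P⇒Q⊎R xs
  ... | yes Px with P⇒Q⊎R Px
  ...   | inj₁ Qx = begin
    suc (count P? xs)                      ≤⟨ s≤s (count-⊎ Q? R? P⇒Q⊎R xs) ⟩
    suc (count Q? xs + count R? xs)        ≤⟨ s≤s (ℕₚ.+-monoʳ-≤ _ (count-cons R? x xs)) ⟩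
    suc (count Q? xs) + count R? (x ∷ xs)  ≡⟨ cong (_+ _) (sym (count-accept Q? Qx)) ⟩
    count Q? (x ∷ xs) + count R? (x ∷ xs)  ∎
    where open ℕₚ.≤-Reasoning
  ...   | inj₂ Rx = begin
    suc (count P? xs)                      ≤⟨ s≤s (count-⊎ Q? R? P⇒Q⊎R xs) ⟩
    suc (count Q? xs + count R? xs)        ≤⟨ s≤s (ℕₚ.+-monoˡ-≤ _ (count-cons Q? x xs)) ⟩
    suc (count Q? (x ∷ xs) + count R? xs)  ≡⟨ sym (ℕₚ.+-suc _ _) ⟩
    count Q? (x ∷ xs) + suc (count R? xs)  ≡⟨ cong (_+_ (count Q? (x ∷ xs))) (sym (count-accept R? Rx)) ⟩
    count Q? (x ∷ xs) + count R? (x ∷ xs)  ∎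
    where open ℕₚ.≤-Reasoning

count-⊎₃ : ∀ {A : Set} {P Q R S : Pred A 0ℓ} (P? : Decidable P) (Q? : Decidable Q)
           (R? : Decidable R) (S? : Decidable S) → (∀ {x} → P x → Q x ⊎ R x ⊎ S x) →
           ∀ xs → count P? xs ≤ count Q? xs + (count R? xs + count S? xs)
count-⊎₃ P? Q? R? S? P⇒Q⊎R⊎S xs =
  ℕₚ.≤-trans (count-⊎ P? Q? R⊎S? P⇒Q⊎R⊎S xs) (ℕₚ.+-monoʳ-≤ (count Q? xs) (count-⊎ R⊎S? R? S? id xs))
  where
  R⊎S? = λ x → R? x ⊎-dec S? x

∈-─⁺ : ∀ {B : Set} {y z : B} {ys} (y∈ys : y ∈ ys) → z ∈ ys → z ≢ y → z ∈ (ys ─ y∈ys)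
∈-─⁺ (here refl) (here refl) z≢y = contradiction refl z≢y
∈-─⁺ (here refl) (there z∈ys) _ = z∈ys
∈-─⁺ (there y∈ys) (here refl) _ = here refl
∈-─⁺ (there y∈ys) (there z∈ys) z≢y = there (∈-─⁺ y∈ys z∈ys z≢y)

length-injection : ∀ {A B : Set} {xs : List A} → Unique xs → (f : A → B) {ys : List B} →
                   (∀ {x} → x ∈ xs → f x ∈ ys) →
                   (∀ {x x'} → x ∈ xs → x' ∈ xs → f x ≡ f x' → x ≡ x') →
                   length xs ≤ length ys
length-injection {xs = []} _ f _ _ = z≤n
length-injection {xs = x ∷ xs} (x∉xs ∷ xs-unique) f {ys} maps-to injective =
  ℕₚ.≤-trans (s≤s bound) (ℕₚ.≤-reflexive (sym (length-removeAt′ ys (index fx∈ys))))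
  where
  fx∈ys = maps-to (here refl)
  bound : length xs ≤ length (ys ─ fx∈ys)
  bound = length-injection xs-unique f
    (λ x'∈xs → ∈-─⁺ fx∈ys (maps-to (there x'∈xs))
                 (λ fx'≡fx → All.lookup x∉xs x'∈xs (injective (here refl) (there x'∈xs) (sym fx'≡fx))))
    (λ x∈ x'∈ → injective (there x∈) (there x'∈))

count-injection : ∀ {A B : Set} {P : Pred A 0ℓ} (P? : Decidable P) {xs : List A} → Unique xs →
                  (f : A → B) {ys : List B} →
                  (∀ {x} → x ∈ xs → P x → f x ∈ ys) →
                  (∀ {x x'} → x ∈ xs → x' ∈ xs → P x → P x' → f x ≡ f x' → x ≡ x') →
                  count P? xs ≤ length ys
count-injection P? xs-unique f maps-to injective =
  length-injection (Unique.filter⁺ P? xs-unique) f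
    (λ x∈ → let (x∈xs , Px) = ∈-filter⁻ P? x∈ in maps-to x∈xs Px)
    (λ x∈ x'∈ → let (x∈xs , Px) = ∈-filter⁻ P? x∈ ; (x'∈xs , Px') = ∈-filter⁻ P? x'∈
                in injective x∈xs x'∈xs Px Px')

sum-≤-count-* : ∀ {A : Set} {Q : Pred A 0ℓ} (Q? : Decidable Q) {g : A → ℕ} {c} →
                (∀ x → g x ≤ c) → (∀ x → ¬ Q x → g x ≡ 0) →
                ∀ xs → sum (map g xs) ≤ count Q? xs * c
sum-≤-count-* Q? bound vanishes [] = z≤n
sum-≤-count-* Q? {g} bound vanishes (x ∷ xs) with Q? x
... | yes _ = ℕₚ.+-mono-≤ (bound x) (sum-≤-count-* Q? bound vanishes xs)
... | no ¬Qx = subst (λ gx → gx + sum (map g xs) ≤ count Q? xs * _) (sym (vanishes x ¬Qx))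
                     (sum-≤-count-* Q? bound vanishes xs)

sum-≤-length-* : ∀ {A : Set} {g : A → ℕ} {c} → (∀ x → g x ≤ c) →
                 ∀ xs → sum (map g xs) ≤ length xs * c
sum-≤-length-* bound [] = z≤n
sum-≤-length-* bound (x ∷ xs) = ℕₚ.+-mono-≤ (bound x) (sum-≤-length-* bound xs)

length-cartesianProduct : ∀ {A B : Set} (xs : List A) (ys : List B) →
                          length (cartesianProduct xs ys) ≡ length xs * length ys
length-cartesianProduct [] ys = refl
length-cartesianProduct (x ∷ xs) ys =
  trans (length-++ (map (x ,_) ys)) (cong₂ _+_ (length-map (x ,_) ys) (length-cartesianProduct xs ys))

∈-range1⁺ : ∀ {K x} → 1 ≤ x → x ≤ K → x ∈ range1 K
∈-range1⁺ {x = suc x} _ x<K = ∈-map⁺ suc (∈-upTo⁺ x<K)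

∈-range1⁻ : ∀ {K x} → x ∈ range1 K → 1 ≤ x × x ≤ K
∈-range1⁻ x∈ with ∈-map⁻ suc x∈
... | _ , y∈upTo , refl = s≤s z≤n , ∈-upTo⁻ y∈upTo

range1-unique : ∀ K → Unique (range1 K)
range1-unique K = Unique.map⁺ ℕₚ.suc-injective (Unique.upTo⁺ K)

length-range1 : ∀ K → length (range1 K) ≡ K
length-range1 K = trans (length-map suc (upTo K)) (length-upTo K)

module Setting (A : M2) (det≡1 : det A ≡ 1ℤ)
               (N : ℕ) .{{_ : NonZero N}} (sqf : Squarefree N) (coprime : Coprime N ∣ disc A ∣)
               (n : V2) (independent : ∀ p → Prime p → p ∣ N → LinIndepMod p (n · A) n)
               (K : ℕ) (ord : IsOrd A N K) where

  open Powers A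
  open InvariantForm A

  PrimeDivisor : ℕ → Set
  PrimeDivisor p = Prime p × p ∣ N

  v : ℕ → V2
  v x = n · (A ^^ x)

  R : List ℕ
  R = range1 K

  A^K≈I : ∀ {m} → m ∣ N → MatrixCongruence._≈ₘ_ m (A ^^ K) I₂
  A^K≈I m∣N = ≈ₘ-divisor m∣N (MatrixCongruence.from-modM N (proj₁ (proj₂ ord)))

  infix 4 _⋈[_]_

  record _⋈[_]_ (x p y : ℕ) : Set where
    constructor ⋈-intro
    field ⋈-elim : VectorCongruence._≈ᵥ_ p (v x +ᵥ v y) 0ᵥ

  _⋈[_]?_ : ∀ x p y → Dec (x ⋈[ p ] y)
  x ⋈[ p ]? y = map′ ⋈-intro _⋈[_]_.⋈-elim (VectorCongruence._≈ᵥ?_ p (v x +ᵥ v y) 0ᵥ)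

  Matched₁ Matched₂ Antipodal : ℕ → Quad → Set
  Matched₁ p (i , j , k , l) = i ~[ p ] j × k ~[ p ] l
  Matched₂ p (i , j , k , l) = i ~[ p ] l × k ~[ p ] j
  Antipodal p (i , j , k , l) = i ⋈[ p ] k × j ⋈[ p ] l

  module AtPrime {p : ℕ} (p-divisor : PrimeDivisor p) where

    p-prime = proj₁ p-divisor
    p∣N = proj₂ p-divisor

    open Congruence p
    open VectorCongruence p
    open MatrixCongruence p
    open PrimeCongruence p-prime
    open PrimeMatrixCongruence p-prime
    open ModuloPrime det≡1 p-prime (λ p∣disc → ¬prime[1] (subst Prime (coprime (p∣N , p∣disc)) p-prime))
    open OverOddPrime p-prime 2≉0 Δ≉0

    δ≉0 : det₂ n (n · A) ≉ 0ℤ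
    δ≉0 = independent⇒det₂≉0 (independent p p-prime p∣N)

    Q-orbit : ∀ x → Q (v x) ≡ det₂ n (n · A)
    Q-orbit x = trans (Q-^^ det≡1 x n) (Q≡det₂ n)

    v≈⇒~ : ∀ {x y} → v x ≈ᵥ v y → x ~[ p ] y
    v≈⇒~ {x} {y} vx≈vy = ~-intro (rows-determine {n} {n · A} {A ^^ x} {A ^^ y} δ≉0 vx≈vy
      (subst₂ _≈ᵥ_ (sym (shifted-row x)) (sym (shifted-row y)) (·-cong vx≈vy (≈ₘ-refl {A}))))
      where
      shifted-row : ∀ x → (n · A) · (A ^^ x) ≡ v x · A
      shifted-row x = begin
        (n · A) · (A ^^ x)  ≡⟨ sym (·-⊗ n A (A ^^ x)) ⟩
        n · (A ⊗ (A ^^ x))  ≡⟨ cong (n ·_) (⊗-^^-comm A x) ⟩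
        n · ((A ^^ x) ⊗ A)  ≡⟨ ·-⊗ n (A ^^ x) A ⟩
        v x · A             ∎
        where open ≡-Reasoning

    Q-v≉0 : ∀ x → Q (v x) ≉ 0ℤ
    Q-v≉0 x Qvx≈0 = δ≉0 (subst (_≈ 0ℤ) (Q-orbit x) Qvx≈0)

    Q-v≈ : ∀ x y → Q (v x) ≈ Q (v y)
    Q-v≈ x y = ≈-reflexive (trans (Q-orbit x) (sym (Q-orbit y)))

    classify : ∀ {q} → IsSol p n A q → Matched₁ p q ⊎ Matched₂ p q ⊎ Antipodal p q
    classify {i , j , k , l} (sol₁ , sol₂) =
      Sum.map (Product.map v≈⇒~ v≈⇒~) (Sum.map (Product.map v≈⇒~ v≈⇒~) (Product.map ⋈-intro ⋈-intro))
        (equal-sums-of-equal-values {v i} {v k} {v j} {v l}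
          (Q-v≉0 i) (Q-v≈ k i) (Q-v≈ j i) (Q-v≈ l i)
          (alternating≈0⇒sums≈ {proj₁ (v i)} {proj₁ (v k)} {proj₁ (v j)} {proj₁ (v l)} (from-mod sol₁) ,
           alternating≈0⇒sums≈ {proj₂ (v i)} {proj₂ (v k)} {proj₂ (v j)} {proj₂ (v l)} (from-mod sol₂)))

    ⋈-unique : ∀ {x y y'} → x ⋈[ p ] y → x ⋈[ p ] y' → y ~[ p ] y'
    ⋈-unique {x} (⋈-intro x+y≈0) (⋈-intro x+y'≈0) =
      v≈⇒~ (+ᵥ-cancelˡ (v x) (≈ᵥ-trans x+y≈0 (≈ᵥ-sym x+y'≈0)))

  module Period {m : ℕ} (m∣N : m ∣ N) = Periodic (A^K≈I m∣N)

  period-minimal : ∀ {x y} → x ∈ R → y ∈ R → x < y → ¬ x ~[ N ] y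
  period-minimal {x} {y} x∈R y∈R x<y x~y =
    proj₂ (proj₂ ord) (y ∸ x) (ℕₚ.m<n⇒0<n∸m x<y) y∸x<K (MatrixCongruence.to-modM N (~-elim (~-sym 0~y∸x)))
    where
    x≤K = proj₂ (∈-range1⁻ x∈R)
    y∸x<K : y ∸ x < K
    y∸x<K = ℕₚ.<-≤-trans (ℕₚ.∸-monoʳ-< (proj₁ (∈-range1⁻ x∈R)) (ℕₚ.<⇒≤ x<y)) (proj₂ (∈-range1⁻ y∈R))
    0~y∸x : 0 ~[ N ] y ∸ x
    0~y∸x = Period.~-cancelˡ ∣-refl x≤K
              (subst₂ (_~[ N ]_) (sym (ℕₚ.+-identityʳ x)) (sym (ℕₚ.m+[n∸m]≡n (ℕₚ.<⇒≤ x<y))) x~y)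

  ~N-injective : ∀ {x y} → x ∈ R → y ∈ R → x ~[ N ] y → x ≡ y
  ~N-injective {x} {y} x∈R y∈R x~y with ℕₚ.<-cmp x y
  ... | tri< x<y _ _ = contradiction x~y (period-minimal x∈R y∈R x<y)
  ... | tri≈ _ x≡y _ = x≡y
  ... | tri> _ _ y<x = contradiction (~-sym x~y) (period-minimal y∈R x∈R y<x)

  separation : ∀ {x y} → x ∈ R → y ∈ R → (∀ p → PrimeDivisor p → x ~[ p ] y) → x ≡ y
  separation x∈R y∈R x~y = ~N-injective x∈R y∈R
    (~-intro (≈ₘ-squarefree sqf (λ p p-prime p∣N → ~-elim (x~y p (p-prime , p∣N)))))

  wrap : ℕ → ℕ
  wrap s with s ≤? K
  ... | yes _ = s
  ... | no _ = s ∸ K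

  wrap-∈ : ∀ {s} → 1 ≤ s → s ≤ K + K → wrap s ∈ R
  wrap-∈ {s} 1≤s s≤2K with s ≤? K
  ... | yes s≤K = ∈-range1⁺ 1≤s s≤K
  ... | no s≰K = ∈-range1⁺ (ℕₚ.m<n⇒0<n∸m (ℕₚ.≰⇒> s≰K))
                           (subst (s ∸ K ≤_) (ℕₚ.m+n∸n≡m K K) (ℕₚ.∸-monoˡ-≤ K s≤2K))

  wrap-~ : ∀ {m} → m ∣ N → ∀ s → wrap s ~[ m ] s
  wrap-~ m∣N s with s ≤? K
  ... | yes _ = ~-refl
  ... | no s≰K = ~-trans (~-sym (Period.~-period m∣N (s ∸ K)))
                         (~-reflexive (ℕₚ.m+[n∸m]≡n (ℕₚ.<⇒≤ (ℕₚ.≰⇒> s≰K))))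

  shift : ℕ → ℕ → ℕ
  shift x y = wrap (K ∸ y + x)

  shift-∈ : ∀ {x} y → x ∈ R → shift x y ∈ R
  shift-∈ {x} y x∈R = wrap-∈ (ℕₚ.≤-trans 1≤x (ℕₚ.m≤n+m x (K ∸ y)))
                              (ℕₚ.+-mono-≤ (ℕₚ.m∸n≤m K y) x≤K)
    where
    1≤x = proj₁ (∈-range1⁻ x∈R)
    x≤K = proj₂ (∈-range1⁻ x∈R)

  shift-~ : ∀ {m} → m ∣ N → ∀ x {y} → y ≤ K → y + shift x y ~[ m ] x
  shift-~ m∣N x {y} y≤K =
    ~-trans (~-+ˡ y (wrap-~ m∣N (K ∸ y + x)))
            (~-trans (~-reflexive y+[K∸y+x]≡K+x) (Period.~-period m∣N x))
    where
    y+[K∸y+x]≡K+x : y + (K ∸ y + x) ≡ K + x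
    y+[K∸y+x]≡K+x = trans (sym (ℕₚ.+-assoc y (K ∸ y) x)) (cong (_+ x) (ℕₚ.m+[n∸m]≡n y≤K))

  add : ℕ → ℕ → ℕ
  add x y = wrap (x + y)

  add-∈ : ∀ {x y} → x ∈ R → y ∈ R → add x y ∈ R
  add-∈ {x} {y} x∈R y∈R = wrap-∈ (ℕₚ.≤-trans (proj₁ (∈-range1⁻ x∈R)) (ℕₚ.m≤m+n x y))
                                 (ℕₚ.+-mono-≤ (proj₂ (∈-range1⁻ x∈R)) (proj₂ (∈-range1⁻ y∈R)))

  add-~ : ∀ {m} → m ∣ N → ∀ x y → add x y ~[ m ] x + y
  add-~ m∣N x y = wrap-~ m∣N (x + y)

  kernel : List ℕ → List ℕ
  kernel ps = filter (λ h → All.all? (λ p → h ~[ p ]? 0) ps) R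

  count-≤-kernel : ∀ {P : Pred ℕ 0ℓ} (P? : Decidable P) {ps} → All PrimeDivisor ps →
                   (∀ {x y} → x ∈ R → y ∈ R → P x → P y → All (λ p → x ~[ p ] y) ps) →
                   count P? R ≤ length (kernel ps)
  count-≤-kernel P? {ps} divisors related = count-≤-from-witness P? λ {x₀} x₀∈R Px₀ →
    let x₀≤K = proj₂ (∈-range1⁻ x₀∈R)
        shifted-~ : ∀ {p} → PrimeDivisor p → ∀ x → x₀ + shift x x₀ ~[ p ] x
        shifted-~ (_ , p∣N) x = shift-~ p∣N x x₀≤K
    in count-injection P? (range1-unique K) (λ x → shift x x₀)
         (λ {x} x∈R Px → ∈-filter⁺ _ (shift-∈ x₀ x∈R)
            (All.zipWith (λ (p-divisor , x~x₀) →
                            Period.~-cancelˡ (proj₂ p-divisor) x₀≤K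
                              (~-trans (shifted-~ p-divisor x)
                                       (~-trans x~x₀ (~-reflexive (sym (ℕₚ.+-identityʳ x₀))))))
                         (divisors , related x∈R x₀∈R Px Px₀)))
         (λ {x} {x'} x∈R x'∈R _ _ shifts≡ → separation x∈R x'∈R λ p p-divisor →
            ~-trans (~-sym (shifted-~ p-divisor x))
                    (~-trans (~-reflexive (cong (_+_ x₀) shifts≡)) (shifted-~ p-divisor x')))

  InKernel : List ℕ → ℕ → Set
  InKernel ps h = h ∈ R × All (λ p → h ~[ p ] 0) ps

  ∈-kernel⁻ : ∀ {ps h} → h ∈ kernel ps → InKernel ps h
  ∈-kernel⁻ = ∈-filter⁻ _

  add-injective : ∀ {ps ps' h h' g g'} → (∀ p → PrimeDivisor p → p ∈ ps ⊎ p ∈ ps') →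
                  InKernel ps h → InKernel ps' h' → InKernel ps g → InKernel ps' g' →
                  add h h' ≡ add g g' → h ≡ g × h' ≡ g'
  add-injective {h = h} {h'} {g} {g'} covers (h∈R , h∈ps) (h'∈R , h'∈ps') (g∈R , g∈ps) (g'∈R , g'∈ps') adds≡ =
    separation h∈R g∈R (λ p pd → proj₁ (both pd)) , separation h'∈R g'∈R (λ p pd → proj₂ (both pd))
    where
    sums~ : ∀ {p} → PrimeDivisor p → h + h' ~[ p ] g + g'
    sums~ (_ , p∣N) = ~-trans (~-sym (add-~ p∣N h h')) (~-trans (~-reflexive adds≡) (add-~ p∣N g g'))
    drop : ∀ {p} x {y} → y ~[ p ] 0 → x + y ~[ p ] x
    drop x y~0 = ~-trans (~-+ˡ x y~0) (~-reflexive (ℕₚ.+-identityʳ x))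
    both : ∀ {p} → PrimeDivisor p → h ~[ p ] g × h' ~[ p ] g'
    both {p} pd with covers p pd
    ... | inj₁ p∈ps =
      let h~0 = All.lookup h∈ps p∈ps ; g~0 = All.lookup g∈ps p∈ps
      in ~-trans h~0 (~-sym g~0) , ~-trans (~-sym (~-+ʳ h' h~0)) (~-trans (sums~ pd) (~-+ʳ g' g~0))
    ... | inj₂ p∈ps' =
      let h'~0 = All.lookup h'∈ps' p∈ps' ; g'~0 = All.lookup g'∈ps' p∈ps'
      in ~-trans (~-sym (drop h h'~0)) (~-trans (sums~ pd) (drop g g'~0)) , ~-trans h'~0 (~-sym g'~0)

  kernel-product : ∀ {ps ps'} → (∀ p → PrimeDivisor p → p ∈ ps ⊎ p ∈ ps') →
                   length (kernel ps) * length (kernel ps') ≤ K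
  kernel-product {ps} {ps'} covers =
    subst₂ _≤_ (length-cartesianProduct (kernel ps) (kernel ps')) (length-range1 K)
      (length-injection (Unique.cartesianProduct⁺ (Unique.filter⁺ _ (range1-unique K))
                                                  (Unique.filter⁺ _ (range1-unique K)))
         (λ (h , h') → add h h') maps-to injective)
    where
    components : ∀ {h h'} → (h , h') ∈ cartesianProduct (kernel ps) (kernel ps') →
                 InKernel ps h × InKernel ps' h'
    components hh'∈ = Product.map ∈-kernel⁻ ∈-kernel⁻ (∈-cartesianProduct⁻ (kernel ps) (kernel ps') hh'∈)
    maps-to : ∀ {hh'} → hh' ∈ cartesianProduct (kernel ps) (kernel ps') → add (proj₁ hh') (proj₂ hh') ∈ R
    maps-to hh'∈ = let ((h∈R , _) , (h'∈R , _)) = components hh'∈ in add-∈ h∈R h'∈R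
    injective : ∀ {hh' gg'} → hh' ∈ cartesianProduct (kernel ps) (kernel ps') →
                gg' ∈ cartesianProduct (kernel ps) (kernel ps') →
                add (proj₁ hh') (proj₂ hh') ≡ add (proj₁ gg') (proj₂ gg') → hh' ≡ gg'
    injective hh'∈ gg'∈ adds≡ =
      let (h∈ , h'∈) = components hh'∈ ; (g∈ , g'∈) = components gg'∈
      in uncurry (cong₂ _,_) (add-injective covers h∈ h'∈ g∈ g'∈ adds≡)

  matched₁? : ∀ p → Decidable (Matched₁ p)
  matched₂? : ∀ p → Decidable (Matched₂ p)
  antipodal? : ∀ p → Decidable (Antipodal p)
  matched₁? p (i , j , k , l) = (i ~[ p ]? j) ×-dec (k ~[ p ]? l)
  matched₂? p (i , j , k , l) = (i ~[ p ]? l) ×-dec (k ~[ p ]? j)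
  antipodal? p (i , j , k , l) = (i ⋈[ p ]? k) ×-dec (j ⋈[ p ]? l)

  Classified : List ℕ → List ℕ → List ℕ → Quad → Set
  Classified ps₁ ps₂ ps₃ q =
    All (λ p → Matched₁ p q) ps₁ × All (λ p → Matched₂ p q) ps₂ × All (λ p → Antipodal p q) ps₃

  classified? : ∀ ps₁ ps₂ ps₃ → Decidable (Classified ps₁ ps₂ ps₃)
  classified? ps₁ ps₂ ps₃ q =
    All.all? (λ p → matched₁? p q) ps₁ ×-dec All.all? (λ p → matched₂? p q) ps₂ ×-dec
    All.all? (λ p → antipodal? p q) ps₃

  module ClassifiedCount {ps₁ ps₂ ps₃ : List ℕ} (divisors₁ : All PrimeDivisor ps₁)
                         (divisors₂ : All PrimeDivisor ps₂) (divisors₃ : All PrimeDivisor ps₃)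
                         (covers : ∀ p → PrimeDivisor p → p ∈ ps₁ ⊎ p ∈ ps₂ ⊎ p ∈ ps₃) where

    good? : Decidable (Classified ps₁ ps₂ ps₃)
    good? = classified? ps₁ ps₂ ps₃

    Admissible₂ : ℕ → ℕ → Set
    Admissible₂ i j = All (λ p → j ~[ p ] i) ps₁

    Admissible₃ : ℕ → ℕ → ℕ → Set
    Admissible₃ i j k = Admissible₂ i j × All (λ p → k ~[ p ] j) ps₂ × All (λ p → i ⋈[ p ] k) ps₃

    admissible₂? : ∀ i → Decidable (Admissible₂ i)
    admissible₂? i j = All.all? (λ p → j ~[ p ]? i) ps₁

    admissible₃? : ∀ i j → Decidable (Admissible₃ i j)
    admissible₃? i j k =
      admissible₂? i j ×-dec All.all? (λ p → k ~[ p ]? j) ps₂ ×-dec All.all? (λ p → i ⋈[ p ]? k) ps₃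

    classified⇒admissible : ∀ {i j k l} → Classified ps₁ ps₂ ps₃ (i , j , k , l) → Admissible₃ i j k
    classified⇒admissible (m₁ , m₂ , a) =
      All.map (~-sym ∘ proj₁) m₁ , All.map proj₂ m₂ , All.map proj₁ a

    l-count : ℕ → ℕ → ℕ → ℕ
    l-count i j k = count (λ l → good? (i , j , k , l)) R

    k-count : ℕ → ℕ → ℕ
    k-count i j = sum (map (l-count i j) R)

    j-count : ℕ → ℕ
    j-count i = sum (map (k-count i) R)

    quads-count : count good? (quads K) ≡ sum (map j-count R)
    quads-count = trans (count-concatMap good? _ R) (cong sum (map-cong j-count-≡ R))
      where
      k-count-≡ : ∀ i j → count good? (concatMap (λ k → map (λ l → (i , j , k , l)) R) R) ≡ k-count i j
      k-count-≡ i j = trans (count-concatMap good? _ R) (cong sum (map-cong (λ k → count-map good? _ R) R))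
      j-count-≡ : ∀ i → count good? (concatMap (λ j → concatMap (λ k → map (λ l → (i , j , k , l)) R) R) R) ≡
                        j-count i
      j-count-≡ i = trans (count-concatMap good? _ R) (cong sum (map-cong (k-count-≡ i) R))

    l-determined : ∀ {i j k l l'} → Classified ps₁ ps₂ ps₃ (i , j , k , l) →
                   Classified ps₁ ps₂ ps₃ (i , j , k , l') → ∀ p → PrimeDivisor p → l ~[ p ] l'
    l-determined (m₁ , m₂ , a) (m₁' , m₂' , a') p p-divisor with covers p p-divisor
    ... | inj₁ p∈ps₁ = ~-trans (~-sym (proj₂ (All.lookup m₁ p∈ps₁))) (proj₂ (All.lookup m₁' p∈ps₁))
    ... | inj₂ (inj₁ p∈ps₂) = ~-trans (~-sym (proj₁ (All.lookup m₂ p∈ps₂))) (proj₁ (All.lookup m₂' p∈ps₂))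
    ... | inj₂ (inj₂ p∈ps₃) =
      AtPrime.⋈-unique p-divisor (proj₂ (All.lookup a p∈ps₃)) (proj₂ (All.lookup a' p∈ps₃))

    l-count-≤1 : ∀ i j k → l-count i j k ≤ 1
    l-count-≤1 i j k = count-injection (λ l → good? (i , j , k , l)) (range1-unique K) (λ _ → 0) {0 ∷ []}
      (λ _ _ → here refl) (λ l∈R l'∈R good good' _ → separation l∈R l'∈R (l-determined good good'))

    l-count-≡0 : ∀ {i j k} → ¬ Admissible₃ i j k → l-count i j k ≡ 0
    l-count-≡0 {i} {j} {k} ¬admissible =
      count-none (λ l → good? (i , j , k , l)) {R} (All.tabulate (λ _ → ¬admissible ∘ classified⇒admissible))

    admissible₃-count-≤ : ∀ i j → count (admissible₃? i j) R ≤ length (kernel (ps₂ ++ ps₃))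
    admissible₃-count-≤ i j = count-≤-kernel (admissible₃? i j) (++⁺ divisors₂ divisors₃)
      λ _ _ (_ , k~j , i⋈k) (_ , k'~j , i⋈k') →
        ++⁺ (All.tabulate λ p∈ → ~-trans (All.lookup k~j p∈) (~-sym (All.lookup k'~j p∈)))
            (All.tabulate λ p∈ → AtPrime.⋈-unique (All.lookup divisors₃ p∈)
                                                 (All.lookup i⋈k p∈) (All.lookup i⋈k' p∈))

    admissible₂-count-≤ : ∀ i → count (admissible₂? i) R ≤ length (kernel ps₁)
    admissible₂-count-≤ i = count-≤-kernel (admissible₂? i) divisors₁
      λ _ _ j~i j'~i → All.tabulate λ p∈ → ~-trans (All.lookup j~i p∈) (~-sym (All.lookup j'~i p∈))

    k-count-≤ : ∀ i j → k-count i j ≤ count (admissible₃? i j) R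
    k-count-≤ i j = subst (k-count i j ≤_) (ℕₚ.*-identityʳ _)
      (sum-≤-count-* (admissible₃? i j) (l-count-≤1 i j) (λ k → l-count-≡0) R)

    k-count-≡0 : ∀ {i j} → ¬ Admissible₂ i j → k-count i j ≡ 0
    k-count-≡0 {i} {j} ¬admissible = ℕₚ.n≤0⇒n≡0 (ℕₚ.≤-trans (k-count-≤ i j)
      (ℕₚ.≤-reflexive (count-none (admissible₃? i j) {R} (All.tabulate (λ _ → ¬admissible ∘ proj₁)))))

    j-count-≤ : ∀ i → j-count i ≤ K
    j-count-≤ i = begin
      j-count i                                                ≤⟨ sum-≤-count-* (admissible₂? i) k-bound
                                                                                 (λ _ → k-count-≡0) R ⟩
      count (admissible₂? i) R * length (kernel (ps₂ ++ ps₃))  ≤⟨ ℕₚ.*-monoˡ-≤ _ (admissible₂-count-≤ i) ⟩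
      length (kernel ps₁) * length (kernel (ps₂ ++ ps₃))       ≤⟨ kernel-product covers₁ ⟩
      K                                                        ∎
      where
      open ℕₚ.≤-Reasoning
      k-bound : ∀ j → k-count i j ≤ length (kernel (ps₂ ++ ps₃))
      k-bound j = ℕₚ.≤-trans (k-count-≤ i j) (admissible₃-count-≤ i j)
      covers₁ : ∀ p → PrimeDivisor p → p ∈ ps₁ ⊎ p ∈ ps₂ ++ ps₃
      covers₁ p p-divisor = Sum.map₂ [ ∈-++⁺ˡ , ∈-++⁺ʳ ps₂ ]′ (covers p p-divisor)

    classified-count-≤ : count good? (quads K) ≤ K * K
    classified-count-≤ = begin
      count good? (quads K)  ≡⟨ quads-count ⟩
      sum (map j-count R)    ≤⟨ sum-≤-length-* j-count-≤ R ⟩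
      length R * K           ≡⟨ cong (_* K) (length-range1 K) ⟩
      K * K                  ∎
      where open ℕₚ.≤-Reasoning

  Covers : List ℕ → List ℕ → List ℕ → List ℕ → Set
  Covers ps ps₁ ps₂ ps₃ = ∀ p → PrimeDivisor p → p ∈ ps ⊎ p ∈ ps₁ ⊎ p ∈ ps₂ ⊎ p ∈ ps₃

  covers-step : ∀ {p ps ps₁ ps₂ ps₃ ps₁' ps₂' ps₃'} → Covers (p ∷ ps) ps₁ ps₂ ps₃ →
                p ∈ ps₁' ⊎ p ∈ ps₂' ⊎ p ∈ ps₃' → ps₁ ⊆ ps₁' → ps₂ ⊆ ps₂' → ps₃ ⊆ ps₃' →
                Covers ps ps₁' ps₂' ps₃'
  covers-step covers p∈' ⊆₁ ⊆₂ ⊆₃ p' p'-divisor with covers p' p'-divisor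
  ... | inj₁ (here refl) = inj₂ p∈'
  ... | inj₁ (there p'∈ps) = inj₁ p'∈ps
  ... | inj₂ p'∈ = inj₂ (Sum.map ⊆₁ (Sum.map ⊆₂ ⊆₃) p'∈)

  Solution : List ℕ → List ℕ → List ℕ → List ℕ → Quad → Set
  Solution ps ps₁ ps₂ ps₃ q = All (λ p → IsSol p n A q) ps × Classified ps₁ ps₂ ps₃ q

  solution? : ∀ ps ps₁ ps₂ ps₃ → Decidable (Solution ps ps₁ ps₂ ps₃)
  solution? ps ps₁ ps₂ ps₃ q = All.all? (λ p → isSol? p n A q) ps ×-dec classified? ps₁ ps₂ ps₃ q

  Solution-split : ∀ {p ps ps₁ ps₂ ps₃ q} → PrimeDivisor p → Solution (p ∷ ps) ps₁ ps₂ ps₃ q →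
                   Solution ps (p ∷ ps₁) ps₂ ps₃ q ⊎ Solution ps ps₁ (p ∷ ps₂) ps₃ q ⊎
                   Solution ps ps₁ ps₂ (p ∷ ps₃) q
  Solution-split p-divisor (sol ∷ sols , m₁ , m₂ , a) =
    Sum.map (λ m → sols , m ∷ m₁ , m₂ , a)
            (Sum.map (λ m → sols , m₁ , m ∷ m₂ , a) (λ m → sols , m₁ , m₂ , m ∷ a))
            (AtPrime.classify p-divisor sol)

  solution-count-≤ : ∀ ps {ps₁ ps₂ ps₃} → All PrimeDivisor ps →
                     All PrimeDivisor ps₁ → All PrimeDivisor ps₂ → All PrimeDivisor ps₃ →
                     Covers ps ps₁ ps₂ ps₃ →
                     count (solution? ps ps₁ ps₂ ps₃) (quads K) ≤ 3 ^ length ps * (K * K)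
  solution-count-≤ [] {ps₁} {ps₂} {ps₃} _ divisors₁ divisors₂ divisors₃ covers = begin
    count (solution? [] ps₁ ps₂ ps₃) (quads K)  ≤⟨ count-mono _ (classified? ps₁ ps₂ ps₃) proj₂ (quads K) ⟩
    count (classified? ps₁ ps₂ ps₃) (quads K)   ≤⟨ classified-count-≤ ⟩
    K * K                                       ≡⟨ sym (ℕₚ.*-identityˡ (K * K)) ⟩
    1 * (K * K)                                 ∎
    where
    open ℕₚ.≤-Reasoning
    open ClassifiedCount divisors₁ divisors₂ divisors₃ (λ p p-divisor → [ (λ ()) , id ]′ (covers p p-divisor))
  solution-count-≤ (p ∷ ps) {ps₁} {ps₂} {ps₃} (p-divisor ∷ divisors) divisors₁ divisors₂ divisors₃ covers =
    ℕₚ.≤-trans (count-⊎₃ (solution? (p ∷ ps) ps₁ ps₂ ps₃) (solution? ps (p ∷ ps₁) ps₂ ps₃)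
                         (solution? ps ps₁ (p ∷ ps₂) ps₃) (solution? ps ps₁ ps₂ (p ∷ ps₃))
                         (Solution-split p-divisor) (quads K))
      (ℕₚ.≤-trans (ℕₚ.+-mono-≤ bound₁ (ℕₚ.+-mono-≤ bound₂ bound₃)) (ℕₚ.≤-reflexive three-copies))
    where
    bound = 3 ^ length ps * (K * K)
    three-copies : bound + (bound + bound) ≡ 3 ^ length (p ∷ ps) * (K * K)
    three-copies = trans (cong (λ x → bound + (bound + x)) (sym (ℕₚ.+-identityʳ bound)))
                         (sym (ℕₚ.*-assoc 3 (3 ^ length ps) (K * K)))
    bound₁ = solution-count-≤ ps divisors (p-divisor ∷ divisors₁) divisors₂ divisors₃
               (covers-step covers (inj₁ (here refl)) there id id)
    bound₂ = solution-count-≤ ps divisors divisors₁ (p-divisor ∷ divisors₂) divisors₃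
               (covers-step covers (inj₂ (inj₁ (here refl))) id there id)
    bound₃ = solution-count-≤ ps divisors divisors₁ divisors₂ (p-divisor ∷ divisors₃)
               (covers-step covers (inj₂ (inj₂ (here refl))) id id there)

prime-divisor? : ∀ N → Decidable (λ p → Prime p × p ∣ N)
prime-divisor? N p = prime? p ×-dec (p ∣? N)

primeDivisors : ℕ → List ℕ
primeDivisors N = filter (prime-divisor? N) (upTo (suc N))

∈-primeDivisors⁺ : ∀ {N p} .{{_ : NonZero N}} → Prime p → p ∣ N → p ∈ primeDivisors N
∈-primeDivisors⁺ {N} p-prime p∣N = ∈-filter⁺ (prime-divisor? N) (∈-upTo⁺ (s≤s (∣⇒≤ p∣N))) (p-prime , p∣N)

primeDivisors-divide : ∀ N → All (λ p → Prime p × p ∣ N) (primeDivisors N)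
primeDivisors-divide N = All.tabulate (λ p∈ → proj₂ (∈-filter⁻ (prime-divisor? N) {xs = upTo (suc N)} p∈))

lemma2 : (A : M2) → det A ≡ + 1 → 2 < ∣ tr A ∣ →
         (N : ℕ) → 1 ≤ N → Squarefree N → Coprime N ∣ disc A ∣ →
         (n : V2) → (∀ p → Prime p → p ∣ N → LinIndepMod p (n · A) n) →
         (K : ℕ) → IsOrd A N K →
         solCount N n A K ≤ (3 ^ ω N) * (K * K)
lemma2 A det≡1 _ N 1≤N sqf coprime n independent K ord = begin
  solCount N n A K                         ≤⟨ count-mono (isSol? N n A) (solution? ps [] [] []) reduce (quads K) ⟩
  count (solution? ps [] [] []) (quads K)  ≤⟨ solution-count-≤ ps (primeDivisors-divide N) [] [] [] covers ⟩
  3 ^ ω N * (K * K)                        ∎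
  where
  instance
    _ = >-nonZero 1≤N
  open ℕₚ.≤-Reasoning
  open Setting A det≡1 N sqf coprime n independent K ord
  ps = primeDivisors N
  reduce : ∀ {q} → IsSol N n A q → Solution ps [] [] [] q
  reduce sol = All.tabulate (λ p∈ → let p∣N = proj₂ (All.lookup (primeDivisors-divide N) p∈)
                                    in Product.map (∣-trans p∣N) (∣-trans p∣N) sol) , [] , [] , []
  covers : Covers ps [] [] []
  covers p (p-prime , p∣N) = inj₁ (∈-primeDivisors⁺ p-prime p∣N)
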